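{- For every integer $n\ge 3$, $\iota_{\rm g}(P_n)\le \iota_{\rm g}'(P_n)\le \left\lfloor\frac{2n+2}{5}\right\rfloor$, where $P_n$ is the path on $n$ vertices.
   Context: All graphs are finite and simple; $N[S]$ denotes the closed neighborhood of a vertex set $S$. In the isolation game on a graph $G$, Dominator and Staller alternately choose vertices; if $S$ is the set of already chosen vertices, a vertex $x$ may be chosen only if it equals or is adjacent to some vertex $y$ lying in a component of $G-N[S]$ that has at least one edge. The game ends when no such vertex exists. Dominator wants to minimize the number of chosen vertices, Staller wants to maximize it. $\iota_{\rm g}(G)$ (resp. $\iota_{\rm g}'(G)$) is the number of chosen vertices under optimal play when Dominator (resp. Staller) moves first. -}

module Defs where

open import Data.Nat using (ℕ; zero; suc; _+_; _⊓_; _⊔_; _≡ᵇ_)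
open import Data.Fin using (Fin; toℕ)
open import Data.Bool using (Bool; true; false; _∨_; _∧_; not)
open import Data.List using (List; []; _∷_; map; filter; foldr)
open import Data.Bool.ListAction using (any)
open import Data.List.Base using (allFin)
open import Relation.Nullary.Decidable using (does)
open import Data.Bool.Properties using (T?)

-- A (finite simple) graph on the vertex set Fin n, given by a Boolean
-- adjacency relation (assumed symmetric and irreflexive).
Graph : ℕ → Set
Graph n = Fin n → Fin n → Bool

Path : (n : ℕ) → Graph n
Path n i j = (suc (toℕ i) ≡ᵇ toℕ j) ∨ (suc (toℕ j) ≡ᵇ toℕ i)

_==_ : ∀ {n} → Fin n → Fin n → Bool
i == j = toℕ i ≡ᵇ toℕ j

module _ {n : ℕ} (G : Graph n) where

  inClosedNbhd : List (Fin n) → Fin n → Bool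
  inClosedNbhd S v = any (λ s → (s == v) ∨ G s v) S

  -- y is a vertex of G - N[S] whose component in G - N[S] has at least one
  -- edge, i.e. y has a neighbour in G - N[S] (a connected component has an
  -- edge iff it has ≥ 2 vertices iff each of its vertices has a neighbour).
  goodVertex : List (Fin n) → Fin n → Bool
  goodVertex S y =
    not (inClosedNbhd S y) ∧
    any (λ z → not (inClosedNbhd S z) ∧ G y z) (allFin n)

  legal : List (Fin n) → Fin n → Bool
  legal S x = any (λ y → goodVertex S y ∧ ((x == y) ∨ G x y)) (allFin n)

  legalMoves : List (Fin n) → List (Fin n)
  legalMoves S = filter (λ x → T? (legal S x)) (allFin n)

data Player : Set where
  dominator staller : Player

other : Player → Player
other dominator = staller
other staller = dominator

best : Player → ℕ → List ℕ → ℕ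
best dominator x xs = foldr _⊓_ x xs
best staller   x xs = foldr _⊔_ x xs

-- Fuel k: every legal move is a vertex not yet chosen, so a game
-- lasts at most n moves and fuel n is never exhausted from S = [].
gameValue : ∀ {n} → Graph n → ℕ → Player → List (Fin n) → ℕ
gameValue G zero p S = 0
gameValue G (suc k) p S with legalMoves G S
... | [] = 0
... | x ∷ xs = suc (best p (val x) (map val xs))
  where
  val : _ → ℕ
  val y = gameValue G k (other p) (y ∷ S)

ιg : ∀ {n} → Graph n → ℕ
ιg {n} G = gameValue G n dominator []

ιg' : ∀ {n} → Graph n → ℕ
ιg' {n} G = gameValue G n staller []

{-# OPTIONS --safe #-}
module Submission where

-- The potential of a position is the sum of weight m over its maximal runs of m
-- undominated vertices. Once a vertex is dominated, the game value is ⌊potential / 8⌋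
-- with Dominator to move and ⌈potential / 8⌉ with Staller to move. Indeed every legal
-- move lowers the potential by 1 to 15; Dominator can lower it by at least
-- 8 + (potential mod 8), playing the second or third vertex of a suitable run; and
-- Staller can lower it by at most the gap 8 − (weight m mod 8) of a run, playing next
-- to it. Gaps divide 8, so the least gap of a position divides its potential, and a
-- drop bounded by such a divisor lowers the ceiling by at most one. An opening move at
-- vertex i of P_n leaves the potential weight (i − 1) + weight (n − i − 2): for a
-- suitable i it is a multiple of 8, so that floor and ceiling agree, which gives
-- ιg ≤ ιg′, and for every i it is small enough for ιg′ ≤ ⌊(2n + 2) / 5⌋.

open import Defs
open import Data.Nat
open import Data.Nat.Properties
open import Data.Nat.DivMod
open import Data.Nat.Divisibility
open import Data.Nat.ListAction using (sum)
open import Data.Nat.ListAction.Properties using (sum-++)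
open import Data.Bool using (Bool; true; false; not; _∧_; _∨_; if_then_else_)
open import Data.Bool.Properties using (∨-zeroʳ; ∨-identityʳ; T-≡; T?)
open import Data.Bool.ListAction using (any)
open import Data.Empty using (⊥; ⊥-elim)
open import Data.Fin using (Fin; toℕ; fromℕ<)
open import Data.Fin.Properties using (toℕ<n; toℕ-fromℕ<)
open import Data.Product using (∃-syntax; ∃₂; _×_; _,_; proj₁; proj₂)
open import Data.Sum using (_⊎_; inj₁; inj₂; swap)
open import Data.List using (List; []; _∷_; _++_; map; allFin)
open import Data.List.Properties using (map-++)
open import Data.List.Membership.Propositional using (_∈_)
open import Data.List.Membership.Propositional.Properties using (∈-filter⁺; ∈-filter⁻; ∈-allFin; ∈-map⁺)
open import Data.List.Relation.Unary.Any using (here; there)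
open import Data.List.Relation.Unary.All using (All; []; _∷_)
import Data.List.Relation.Unary.All as All
import Data.List.Relation.Unary.All.Properties as All
open import Function using (Equivalence)
open import Relation.Nullary using (yes; no)
open import Relation.Nullary.Decidable using (Dec; from-yes; _×-dec_; _→-dec_)
open import Relation.Binary.PropositionalEquality


-- Periodic induction and division by 8

period5-ind : (P : ℕ → Set) → (∀ {m} → m < 7 → P m) → (∀ m → P (2 + m) → P (7 + m)) → ∀ m → P m
period5-ind P base step 0 = base (s≤s z≤n)
period5-ind P base step 1 = base (s≤s (s≤s z≤n))
period5-ind P base step 2 = base (s≤s (s≤s (s≤s z≤n)))
period5-ind P base step 3 = base (s≤s (s≤s (s≤s (s≤s z≤n))))
period5-ind P base step 4 = base (s≤s (s≤s (s≤s (s≤s (s≤s z≤n)))))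
period5-ind P base step 5 = base (s≤s (s≤s (s≤s (s≤s (s≤s (s≤s z≤n))))))
period5-ind P base step 6 = base (s≤s (s≤s (s≤s (s≤s (s≤s (s≤s (s≤s z≤n)))))))
period5-ind P base step (suc (suc (suc (suc (suc (suc (suc m))))))) =
  step m (period5-ind P base step (suc (suc m)))

period5-ind₂ : (P : ℕ → ℕ → Set) → (∀ {a b} → a < 7 → b < 7 → P a b) →
               (∀ a b → P (2 + a) b → P (7 + a) b) → (∀ {a b} → P a b → P b a) → ∀ a b → P a b
period5-ind₂ P base step sym-P =
  period5-ind (λ a → ∀ b → P a b) (λ a<7 b → sym-P (along-first a<7 b)) (λ a h b → step a b (h b))
  where
  along-first : ∀ {a} → a < 7 → ∀ b → P b a
  along-first a<7 = period5-ind (λ b → P b _) (λ b<7 → base b<7 a<7) (λ b → step b _)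

∣-<+⇒≤ : ∀ {d a b} → d ∣ a → d ∣ b → a < b + d → a ≤ b
∣-<+⇒≤ {d} (divides-refl p) (divides-refl q) lt =
  *-monoˡ-≤ d (≤-pred (*-cancelʳ-< d p (suc q) (subst (p * d <_) (+-comm (q * d) d) lt)))

divisors-of-8-chain : ∀ {d e} → d ∣ 8 → e ∣ 8 → d ≤ e → d ∣ e
divisors-of-8-chain {d} {e} d∣8 e∣8 = checked (s≤s (∣⇒≤ d∣8)) (s≤s (∣⇒≤ e∣8)) d∣8 e∣8
  where
  checked : ∀ {d} → d < 9 → ∀ {e} → e < 9 → d ∣ 8 → e ∣ 8 → d ≤ e → d ∣ e
  checked = from-yes (allUpTo? (λ d → allUpTo? (λ e → d ∣? 8 →-dec e ∣? 8 →-dec d ≤? e →-dec d ∣? e) 9) 9)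

⌈_/8⌉ : ℕ → ℕ
⌈ W /8⌉ = (W + 7) / 8

<[1+/8]*8 : ∀ X → X < suc (X / 8) * 8
<[1+/8]*8 X = begin-strict
  X                 ≡⟨ m≡m%n+[m/n]*n X 8 ⟩
  X % 8 + X / 8 * 8 <⟨ +-monoˡ-< (X / 8 * 8) (m%n<n X 8) ⟩
  8 + X / 8 * 8     ∎
  where open ≤-Reasoning

*8≤⇒≤/8 : ∀ {q X} → q * 8 ≤ X → q ≤ X / 8
*8≤⇒≤/8 {q} {X} h = subst (_≤ X / 8) (m*n/n≡m q 8) (/-monoˡ-≤ 8 h)

≤+15⇒⌊/8⌋≤1+⌈/8⌉ : ∀ {W W′} → W ≤ W′ + 15 → W / 8 ≤ suc ⌈ W′ /8⌉
≤+15⇒⌊/8⌋≤1+⌈/8⌉ {W} {W′} h = ≤-pred (m<n*o⇒m/o<n (begin-strict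
  W                          ≤⟨ h ⟩
  W′ + 15                    ≡⟨ trans (sym (+-assoc W′ 7 8)) (+-comm (W′ + 7) 8) ⟩
  8 + (W′ + 7)               <⟨ +-monoʳ-< 8 (<[1+/8]*8 (W′ + 7)) ⟩
  suc (suc ⌈ W′ /8⌉) * 8     ∎))
  where open ≤-Reasoning

+8+%8≤⇒1+⌈/8⌉≤⌊/8⌋ : ∀ {W W′} → W′ + (8 + W % 8) ≤ W → suc ⌈ W′ /8⌉ ≤ W / 8
+8+%8≤⇒1+⌈/8⌉≤⌊/8⌋ {W} {W′} h = *-cancelʳ-< 8 ⌈ W′ /8⌉ (W / 8) (begin-strict
  ⌈ W′ /8⌉ * 8     ≤⟨ m/n*n≤m (W′ + 7) 8 ⟩
  W′ + 7           <⟨ ≤-reflexive (sym (+-suc W′ 7)) ⟩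
  W′ + 8           ≤⟨ +-cancelʳ-≤ (W % 8) (W′ + 8) (W / 8 * 8) W′+8+W%8≤ ⟩
  W / 8 * 8        ∎)
  where
  open ≤-Reasoning
  W′+8+W%8≤ : W′ + 8 + W % 8 ≤ W / 8 * 8 + W % 8
  W′+8+W%8≤ = subst₂ _≤_ (sym (+-assoc W′ 8 (W % 8))) (trans (m≡m%n+[m/n]*n W 8) (+-comm (W % 8) (W / 8 * 8))) h

<⇒1+⌊/8⌋≤⌈/8⌉ : ∀ {W W′} → W′ < W → suc (W′ / 8) ≤ ⌈ W /8⌉
<⇒1+⌊/8⌋≤⌈/8⌉ {W} {W′} h = *8≤⇒≤/8 (begin
  8 + W′ / 8 * 8   ≤⟨ +-monoʳ-≤ 8 (m/n*n≤m W′ 8) ⟩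
  7 + suc W′       ≤⟨ +-monoʳ-≤ 7 h ⟩
  7 + W            ≡⟨ +-comm 7 W ⟩
  W + 7            ∎)
  where open ≤-Reasoning

∣8∣⇒⌈/8⌉≤1+⌊/8⌋ : ∀ {d W W′} → d ∣ 8 → d ∣ W → W ≤ W′ + d → ⌈ W /8⌉ ≤ suc (W′ / 8)
∣8∣⇒⌈/8⌉≤1+⌊/8⌋ {d} {W} {W′} d∣8 d∣W h = ≤-pred (m<n*o⇒m/o<n (begin-strict
  W + 7   ≤⟨ +-monoˡ-≤ 7 W≤M ⟩
  M + 7   <⟨ +-monoʳ-< M ≤-refl ⟩
  M + 8   ≡⟨ +-comm M 8 ⟩
  8 + M   ∎))
  where
  open ≤-Reasoning
  M : ℕ
  M = suc (W′ / 8) * 8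
  W≤M : W ≤ M
  W≤M = ∣-<+⇒≤ d∣W (∣-trans d∣8 (n∣m*n (suc (W′ / 8)))) (≤-<-trans h (+-monoˡ-< d (<[1+/8]*8 W′)))

8∣⇒⌈/8⌉≡/8 : ∀ {W} → 8 ∣ W → ⌈ W /8⌉ ≡ W / 8
8∣⇒⌈/8⌉≡/8 {W} 8∣W = trans (+-distrib-/-∣ˡ {W} 7 {8} 8∣W) (+-identityʳ (W / 8))

[16+X]/8≡2+X/8 : ∀ X → (16 + X) / 8 ≡ 2 + X / 8
[16+X]/8≡2+X/8 X = +-distrib-/-∣ˡ {16} X {8} (divides 2 refl)

[2[5+n]+2]/5≡2+[2n+2]/5 : ∀ n → (2 * (5 + n) + 2) / 5 ≡ 2 + (2 * n + 2) / 5
[2[5+n]+2]/5≡2+[2n+2]/5 n =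
  trans (cong (_/ 5) 2[5+n]+2≡10+[2n+2]) (+-distrib-/-∣ˡ {10} (2 * n + 2) {5} (divides 2 refl))
  where
  2[5+n]+2≡10+[2n+2] : 2 * (5 + n) + 2 ≡ 10 + (2 * n + 2)
  2[5+n]+2≡10+[2n+2] = cong (_+ 2) (*-distribˡ-+ 2 5 n)

1+a+[2+b]≡3+a+b : ∀ a b → suc a + suc (suc b) ≡ 3 + a + b
1+a+[2+b]≡3+a+b a b = cong suc (trans (+-suc a (suc b)) (cong suc (+-suc a b)))

-- Weights of runs

-- ⌊weight m / 8⌋ and ⌈weight m / 8⌉ are the values of a lone run of m undominated
-- vertices; five more vertices always cost two more moves.
weight : ℕ → ℕ
weight 0 = 0
weight 1 = 0
weight 2 = 8
weight 3 = 12
weight 4 = 14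
weight 5 = 15
weight 6 = 16
weight (suc (suc (suc (suc (suc (suc (suc m))))))) = 16 + weight (suc (suc m))

weight-5+ : ∀ m → weight (6 + m) ≡ 16 + weight (1 + m)
weight-5+ zero    = refl
weight-5+ (suc m) = refl

<2⇒weight≡0 : ∀ {m} → m < 2 → weight m ≡ 0
<2⇒weight≡0 (s≤s z≤n)       = refl
<2⇒weight≡0 (s≤s (s≤s z≤n)) = refl

weightSum : List ℕ → ℕ
weightSum L = sum (map weight L)

Drop : ℕ → ℕ → Set
Drop W W′ = W′ < W × W ≤ W′ + 15

drop? : ∀ W W′ → Dec (Drop W W′)
drop? W W′ = (W′ <? W) ×-dec (W ≤? W′ + 15)

Drop-+ˡ : ∀ K {W W′} → Drop W W′ → Drop (K + W) (K + W′)
Drop-+ˡ K {W} {W′} (lo , hi) =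
  +-monoʳ-< K lo , subst (K + W ≤_) (sym (+-assoc K W′ 15)) (+-monoʳ-≤ K hi)

weight-drop-interior : ∀ a b → Drop (weight (3 + a + b)) (weight a + weight b)
weight-drop-interior = period5-ind₂ _ (λ a<7 b<7 → checked a<7 b<7) (λ _ _ → Drop-+ˡ 16)
  λ {a} {b} → subst₂ Drop (cong (λ s → weight (3 + s)) (+-comm a b)) (+-comm (weight a) (weight b))
  where
  checked : ∀ {a} → a < 7 → ∀ {b} → b < 7 → Drop (weight (3 + a + b)) (weight a + weight b)
  checked = from-yes (allUpTo? (λ a → allUpTo? (λ b → drop? (weight (3 + a + b)) (weight a + weight b)) 7) 7)

weight-drop-edge : ∀ b → Drop (weight (2 + b)) (weight b)
weight-drop-edge = period5-ind _ (from-yes (allUpTo? (λ b → drop? (weight (2 + b)) (weight b)) 7)) (λ _ → Drop-+ˡ 16)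

weight-drop-split : ∀ i t → 1 ≤ t → 2 ≤ i + t → Drop (weight (i + t)) (weight (i ∸ 1) + weight (t ∸ 2))
weight-drop-split zero          (suc (suc b))  _ _ = weight-drop-edge b
weight-drop-split zero          (suc zero)     _ (s≤s ())
weight-drop-split (suc zero)    (suc zero)     _ _ = from-yes (drop? 8 0)
weight-drop-split (suc (suc a)) (suc zero)     _ _ =
  subst₂ Drop (cong weight (+-comm 1 (2 + a))) (sym (+-identityʳ _)) (weight-drop-edge (suc a))
weight-drop-split (suc a)       (suc (suc b))  _ _ =
  subst (λ s → Drop (weight s) (weight a + weight b)) (sym (1+a+[2+b]≡3+a+b a b)) (weight-drop-interior a b)

weight-%8-period : ∀ m → weight (7 + m) % 8 ≡ weight (2 + m) % 8
weight-%8-period m = trans (cong (_% 8) (+-comm 16 (weight (2 + m)))) ([m+kn]%n≡m%n (weight (2 + m)) 2 8)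

gap : ℕ → ℕ
gap m = 8 ∸ weight m % 8

gap-period : ∀ m → gap (7 + m) ≡ gap (2 + m)
gap-period m = cong (8 ∸_) (weight-%8-period m)

gap≤8 : ∀ m → gap m ≤ 8
gap≤8 m = m∸n≤m 8 (weight m % 8)

weight%8+gap≡8 : ∀ m → weight m % 8 + gap m ≡ 8
weight%8+gap≡8 m = trans (+-comm (weight m % 8) (gap m)) (m∸n+n≡m (m%n≤n (weight m) 8))

gap∣8×gap∣weight%8 : ∀ m → gap m ∣ 8 × gap m ∣ weight m % 8
gap∣8×gap∣weight%8 = period5-ind _ (from-yes (allUpTo? (λ m → (gap m ∣? 8) ×-dec (gap m ∣? weight m % 8)) 7))
  λ m → subst₂ (λ g r → g ∣ 8 × g ∣ r) (sym (gap-period m)) (sym (weight-%8-period m))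

gap∣8 : ∀ m → gap m ∣ 8
gap∣8 m = proj₁ (gap∣8×gap∣weight%8 m)

gap∣weight : ∀ m → gap m ∣ weight m
gap∣weight m = ∣n∣m%n⇒∣m (gap∣8 m) (proj₂ (gap∣8×gap∣weight%8 m))

gap∣⇒%8≤ : ∀ {m W} → gap m ∣ W → W % 8 ≤ weight m % 8
gap∣⇒%8≤ {m} {W} gm∣W = ∣-<+⇒≤ (%-presˡ-∣ gm∣W (gap∣8 m)) (proj₂ (gap∣8×gap∣weight%8 m))
  (subst (W % 8 <_) (sym (weight%8+gap≡8 m)) (m%n<n W 8))

weight-drop-end≤gap : ∀ m → weight m ≤ weight (m ∸ 1) + gap m
weight-drop-end≤gap = period5-ind _ (from-yes (allUpTo? (λ m → weight m ≤? weight (m ∸ 1) + gap m) 7)) step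
  where
  step : ∀ m → weight (2 + m) ≤ weight (1 + m) + gap (2 + m) → weight (7 + m) ≤ weight (6 + m) + gap (7 + m)
  step m h = subst₂ (λ w g → weight (7 + m) ≤ w + g) (sym (weight-5+ m)) (sym (gap-period m)) (+-monoʳ-≤ 16 h)

weight-drop-end : ∀ m → 2 ≤ m → Drop (weight m) (weight (m ∸ 1))
weight-drop-end (suc zero)    (s≤s ())
weight-drop-end (suc (suc b)) _ =
  increasing b , ≤-trans (weight-drop-end≤gap (2 + b)) (+-monoʳ-≤ (weight (1 + b)) (≤-trans (gap≤8 (2 + b)) 8≤15))
  where
  8≤15 : 8 ≤ 15
  8≤15 = m≤m+n 8 7
  increasing : ∀ b → weight (1 + b) < weight (2 + b)
  increasing = period5-ind _ (from-yes (allUpTo? (λ b → weight (1 + b) <? weight (2 + b)) 7)) (λ _ → +-monoʳ-< 16)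

-- Dominator plays the second vertex of a run of length 2, the third of a longer one.
dominator-split : ∀ m → 2 ≤ m →
  ∃₂ λ a t → m ≡ suc a + t × 1 ≤ t × weight a + weight (t ∸ 2) + (8 + weight m % 8) ≤ weight m
dominator-split (suc zero)          (s≤s ())
dominator-split (suc (suc zero))    _ = 0 , 1 , refl , s≤s z≤n , ≤-refl
dominator-split (suc (suc (suc b))) _ = 1 , suc b , refl , s≤s z≤n , third-vertex b
  where
  third-vertex : ∀ b → weight (b ∸ 1) + (8 + weight (3 + b) % 8) ≤ weight (3 + b)
  third-vertex = period5-ind _
    (from-yes (allUpTo? (λ b → weight (b ∸ 1) + (8 + weight (3 + b) % 8) ≤? weight (3 + b)) 7)) step
    where
    step : ∀ b → weight (1 + b) + (8 + weight (5 + b) % 8) ≤ weight (5 + b) →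
           weight (6 + b) + (8 + weight (10 + b) % 8) ≤ weight (10 + b)
    step b h = subst₂ (λ w r → w + (8 + r) ≤ weight (10 + b)) (sym (weight-5+ b)) (sym (weight-%8-period (3 + b)))
                      (+-monoʳ-≤ 16 h)

-- Gaps are divisors of 8, which form a chain under divisibility: the least gap
-- divides every weight.
run-whose-gap-divides : ∀ L → weightSum L ≡ 0 ⊎ ∃[ m ] m ∈ L × 2 ≤ m × gap m ∣ weightSum L
run-whose-gap-divides [] = inj₁ refl
run-whose-gap-divides (x ∷ L) with 2 ≤? x | run-whose-gap-divides L
... | no x≱2 | inj₁ W≡0 = inj₁ (cong₂ _+_ (<2⇒weight≡0 (≰⇒> x≱2)) W≡0)
... | no x≱2 | inj₂ (m , m∈L , 2≤m , gm∣W) =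
  inj₂ (m , there m∈L , 2≤m , subst (λ w → gap m ∣ w + weightSum L) (sym (<2⇒weight≡0 (≰⇒> x≱2))) gm∣W)
... | yes 2≤x | inj₁ W≡0 =
  inj₂ (x , here refl , 2≤x , ∣m∣n⇒∣m+n (gap∣weight x) (subst (gap x ∣_) (sym W≡0) (divides 0 refl)))
... | yes 2≤x | inj₂ (m , m∈L , 2≤m , gm∣W) with gap x ≤? gap m
...   | yes gx≤gm = inj₂ (x , here refl , 2≤x ,
  ∣m∣n⇒∣m+n (gap∣weight x) (∣-trans (divisors-of-8-chain (gap∣8 x) (gap∣8 m) gx≤gm) gm∣W))
...   | no gx≰gm  = inj₂ (m , there m∈L , 2≤m ,
  ∣m∣n⇒∣m+n (∣-trans (divisors-of-8-chain (gap∣8 m) (gap∣8 x) (≰⇒≥ gx≰gm)) (gap∣weight x)) gm∣W)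

opening-bound-leaf : ∀ b → suc (weight (1 + b) / 8) ≤ (2 * (3 + b) + 2) / 5
opening-bound-leaf = period5-ind _ (from-yes (allUpTo? (λ b → suc (weight (1 + b) / 8) ≤? (2 * (3 + b) + 2) / 5) 7))
  λ b h → subst₂ (λ l r → suc l ≤ r) (sym ([16+X]/8≡2+X/8 (weight (3 + b)))) (sym ([2[5+n]+2]/5≡2+[2n+2]/5 (5 + b)))
                 (+-monoʳ-≤ 2 h)

opening-bound-inner : ∀ a b → suc ((weight a + weight b) / 8) ≤ (2 * (3 + a + b) + 2) / 5
opening-bound-inner = period5-ind₂ _ (λ a<7 b<7 → checked a<7 b<7)
  (λ a b h → subst₂ (λ l r → suc l ≤ r) (sym ([16+X]/8≡2+X/8 (weight (2 + a) + weight b)))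
                    (sym ([2[5+n]+2]/5≡2+[2n+2]/5 (5 + a + b))) (+-monoʳ-≤ 2 h))
  λ {a} {b} → subst₂ (λ l r → suc (l / 8) ≤ r) (+-comm (weight a) (weight b))
                     (cong (λ s → (2 * (3 + s) + 2) / 5) (+-comm a b))
  where
  checked : ∀ {a} → a < 7 → ∀ {b} → b < 7 → suc ((weight a + weight b) / 8) ≤ (2 * (3 + a + b) + 2) / 5
  checked = from-yes (allUpTo? (λ a → allUpTo? (λ b →
    suc ((weight a + weight b) / 8) ≤? (2 * (3 + a + b) + 2) / 5) 7) 7)

opening-bound-split : ∀ i t → 1 ≤ t → 3 ≤ i + t →
                   suc ((weight (i ∸ 1) + weight (t ∸ 2)) / 8) ≤ (2 * (i + t) + 2) / 5
opening-bound-split zero          (suc (suc (suc b))) _ _ = opening-bound-leaf b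
opening-bound-split (suc (suc a)) (suc zero)          _ _ =
  subst₂ (λ l r → suc (l / 8) ≤ (2 * r + 2) / 5) (sym (+-identityʳ (weight (1 + a)))) (+-comm 1 (2 + a))
         (opening-bound-leaf a)
opening-bound-split (suc a)       (suc (suc b))       _ _ =
  subst (λ s → suc ((weight a + weight b) / 8) ≤ (2 * s + 2) / 5) (sym (1+a+[2+b]≡3+a+b a b))
        (opening-bound-inner a b)
opening-bound-split zero          (suc zero)          _ (s≤s ())
opening-bound-split zero          (suc (suc zero))    _ (s≤s (s≤s ()))
opening-bound-split (suc zero)    (suc zero)          _ (s≤s (s≤s ()))

balanced-opening-split : ∀ k → ∃₂ λ i t → i + t ≡ 3 + k × 3 ≤ t × 8 ∣ weight (i ∸ 1) + weight (t ∸ 2)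
balanced-opening-split 0 = 0 , 3 , refl , ≤-refl , divides 0 refl
balanced-opening-split 1 = 0 , 4 , refl , m≤n+m 3 1 , divides 1 refl
balanced-opening-split 2 = 1 , 4 , refl , m≤n+m 3 1 , divides 1 refl
balanced-opening-split 3 = 2 , 4 , refl , m≤n+m 3 1 , divides 1 refl
balanced-opening-split 4 = 3 , 4 , refl , m≤n+m 3 1 , divides 2 refl
balanced-opening-split (suc (suc (suc (suc (suc k))))) with balanced-opening-split k
... | _ , 1 , _ , s≤s () , _
... | _ , 2 , _ , s≤s (s≤s ()) , _
... | i , t@(suc (suc (suc s))) , i+t≡3+k , 3≤t , 8∣F =
  i , 5 + t , trans (+-comm i (5 + t)) (cong (5 +_) (trans (+-comm t i) i+t≡3+k)) , ≤-trans 3≤t (m≤n+m t 5) ,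
  subst (8 ∣_) 16+F≡F′ (∣m∣n⇒∣m+n (divides 2 refl) 8∣F)
  where
  x : ℕ
  x = weight (i ∸ 1)
  16+F≡F′ : 16 + (x + weight (1 + s)) ≡ x + weight (6 + s)
  16+F≡F′ = begin
    16 + (x + weight (1 + s))  ≡⟨ cong (_+ weight (1 + s)) (+-comm 16 x) ⟩
    x + 16 + weight (1 + s)    ≡⟨ +-assoc x 16 (weight (1 + s)) ⟩
    x + (16 + weight (1 + s))  ≡⟨ cong (x +_) (sym (weight-5+ s)) ⟩
    x + weight (6 + s)         ∎
    where open ≡-Reasoning

-- Runs of undominated vertices on a path

≡true⇒≢false : ∀ {b} → b ≡ true → b ≡ false → ⊥
≡true⇒≢false refl ()

∨-true⁻ : ∀ {x y} → x ∨ y ≡ true → x ≡ true ⊎ y ≡ true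
∨-true⁻ {true}  _ = inj₁ refl
∨-true⁻ {false} e = inj₂ e

∨-trueˡ : ∀ {x} y → x ≡ true → x ∨ y ≡ true
∨-trueˡ _ refl = refl

∨-trueʳ : ∀ x {y} → y ≡ true → x ∨ y ≡ true
∨-trueʳ x refl = ∨-zeroʳ x

∧-true⁻ : ∀ {x y} → x ∧ y ≡ true → x ≡ true × y ≡ true
∧-true⁻ {true} e = refl , e

∧-true⁺ : ∀ {x y} → x ≡ true → y ≡ true → x ∧ y ≡ true
∧-true⁺ refl refl = refl

not-true⁻ : ∀ {b} → not b ≡ true → b ≡ false
not-true⁻ {false} _ = refl

not-true⁺ : ∀ {b} → b ≡ false → not b ≡ true
not-true⁺ refl = refl

≡ᵇ-true⁻ : ∀ {a b} → (a ≡ᵇ b) ≡ true → a ≡ b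
≡ᵇ-true⁻ {a} {b} e = ≡ᵇ⇒≡ a b (Equivalence.from T-≡ e)

≡ᵇ-refl : ∀ a → (a ≡ᵇ a) ≡ true
≡ᵇ-refl zero    = refl
≡ᵇ-refl (suc a) = ≡ᵇ-refl a

≡ᵇ-true⁺ : ∀ {a b} → a ≡ b → (a ≡ᵇ b) ≡ true
≡ᵇ-true⁺ {a} refl = ≡ᵇ-refl a

N[_] : ℕ → ℕ → Bool
N[ x ] j = (x ≡ᵇ j) ∨ ((suc x ≡ᵇ j) ∨ (suc j ≡ᵇ x))

N[]-true⁻ : ∀ {x j} → N[ x ] j ≡ true → x ≡ j ⊎ suc x ≡ j ⊎ suc j ≡ x
N[]-true⁻ {x} {j} e with ∨-true⁻ {x ≡ᵇ j} e
... | inj₁ x≡j = inj₁ (≡ᵇ-true⁻ x≡j)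
... | inj₂ e′ with ∨-true⁻ {suc x ≡ᵇ j} e′
...   | inj₁ 1+x≡j = inj₂ (inj₁ (≡ᵇ-true⁻ 1+x≡j))
...   | inj₂ 1+j≡x = inj₂ (inj₂ (≡ᵇ-true⁻ 1+j≡x))

N[]-self : ∀ x → N[ x ] x ≡ true
N[]-self x = ∨-trueˡ _ (≡ᵇ-refl x)

N[]-suc : ∀ x → N[ x ] (suc x) ≡ true
N[]-suc x = ∨-trueʳ (x ≡ᵇ suc x) (∨-trueˡ _ (≡ᵇ-refl x))

N[]-pred : ∀ x → N[ suc x ] x ≡ true
N[]-pred x = ∨-trueʳ (suc x ≡ᵇ x) (∨-trueʳ (suc (suc x) ≡ᵇ x) (≡ᵇ-refl x))

N[]-far : ∀ {x j} → 2 + j ≤ x ⊎ 2 + x ≤ j → N[ x ] j ≡ false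
N[]-far {x} {j} far with N[ x ] j in e
... | false = refl
... | true with N[]-true⁻ {x} {j} e | far
...   | inj₁ refl         | inj₁ h = ⊥-elim (1+n≰n (≤-trans (n≤1+n _) h))
...   | inj₁ refl         | inj₂ h = ⊥-elim (1+n≰n (≤-trans (n≤1+n _) h))
...   | inj₂ (inj₁ refl)  | inj₁ h = ⊥-elim (1+n≰n (≤-trans (m≤n+m _ 2) h))
...   | inj₂ (inj₁ refl)  | inj₂ h = ⊥-elim (1+n≰n h)
...   | inj₂ (inj₂ refl)  | inj₁ h = ⊥-elim (1+n≰n h)
...   | inj₂ (inj₂ refl)  | inj₂ h = ⊥-elim (1+n≰n (≤-trans (m≤n+m _ 2) h))

play : ℕ → (ℕ → Bool) → ℕ → Bool
play x c j = N[ x ] j ∨ c j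

play-true : ∀ x c {j} → c j ≡ true → play x c j ≡ true
play-true x c e = ∨-trueʳ (N[ x ] _) e

play-N[] : ∀ x c {j} → N[ x ] j ≡ true → play x c j ≡ true
play-N[] x c {j} e = ∨-trueˡ (c j) e

-- runs c i len acc lists the lengths of the maximal blocks of consecutive vertices in
-- i, …, i + len − 1 on which c is false (empty blocks included), the first block
-- being prolonged by acc.
runs : (ℕ → Bool) → ℕ → ℕ → ℕ → List ℕ
runs c i zero      acc = acc ∷ []
runs c i (suc len) acc = if c i then acc ∷ runs c (suc i) len 0 else runs c (suc i) len (suc acc)

opaque
  potential : (ℕ → Bool) → ℕ → ℕ
  potential c n = weightSum (runs c 0 n 0)

  potential-runs : ∀ c n → potential c n ≡ weightSum (runs c 0 n 0)
  potential-runs c n = refl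

weightSum-++ : ∀ xs ys → weightSum (xs ++ ys) ≡ weightSum xs + weightSum ys
weightSum-++ xs ys = trans (cong sum (map-++ weight xs ys)) (sum-++ (map weight xs) (map weight ys))

Within : (ℕ → Set) → ℕ → ℕ → Set
Within P i len = ∀ {j} → i ≤ j → j < i + len → P j

Within-head : ∀ {P i len} → Within P i (suc len) → P i
Within-head {i = i} h = h ≤-refl (m<m+n i z<s)

Within-tail : ∀ {P i len} → Within P i (suc len) → Within P (suc i) len
Within-tail {i = i} {len} h {j} i<j j<end = h (<⇒≤ i<j) (subst (j <_) (sym (+-suc i len)) j<end)

empty-interval : ∀ {i j} → i ≤ j → j < i + 0 → ⊥
empty-interval {i} i≤j j<i+0 = <⇒≱ (subst (_ <_) (+-identityʳ i) j<i+0) i≤j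

Within-empty : ∀ {P i} → Within P i 0
Within-empty i≤j j<i+0 = ⊥-elim (empty-interval i≤j j<i+0)

Free : (ℕ → Bool) → ℕ → ℕ → Set
Free c = Within (λ j → c j ≡ false)

runs-cong : ∀ {c c′ i len acc} → Within (λ j → c j ≡ c′ j) i len → runs c i len acc ≡ runs c′ i len acc
runs-cong {len = zero} _ = refl
runs-cong {c} {c′} {i} {suc len} {acc} agree rewrite Within-head agree with c′ i
... | true  = cong (acc ∷_) (runs-cong (Within-tail agree))
... | false = runs-cong (Within-tail agree)

runs-free : ∀ {c i a acc} → Free c i a → runs c i a acc ≡ (a + acc) ∷ []
runs-free {a = zero} _ = refl
runs-free {c} {i} {suc a} {acc} free rewrite Within-head free =
  trans (runs-free (Within-tail free)) (cong (_∷ []) (+-suc a acc))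

runs-split : ∀ {c i a b acc} → c (i + a) ≡ true →
             runs c i (a + suc b) acc ≡ runs c i a acc ++ runs c (suc (i + a)) b 0
runs-split {c} {i} {zero} {b} {acc} e rewrite +-identityʳ i | e = refl
runs-split {c} {i} {suc a} {b} {acc} e = by-first-vertex
  where
  ih : ∀ acc′ → runs c (suc i) (a + suc b) acc′ ≡ runs c (suc i) a acc′ ++ runs c (suc (i + suc a)) b 0
  ih acc′ = subst (λ k → runs c (suc i) (a + suc b) acc′ ≡ runs c (suc i) a acc′ ++ runs c (suc k) b 0)
                  (sym (+-suc i a)) (runs-split {c} {suc i} {a} {b} {acc′} (subst (λ k → c k ≡ true) (+-suc i a) e))
  by-first-vertex : runs c i (suc a + suc b) acc ≡ runs c i (suc a) acc ++ runs c (suc (i + suc a)) b 0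
  by-first-vertex with c i
  ... | true  = cong (acc ∷_) (ih 0)
  ... | false = ih (suc acc)

weightSum-free : ∀ {c i m} → Free c i m → weightSum (runs c i m 0) ≡ weight m
weightSum-free {m = m} free =
  trans (cong weightSum (runs-free free)) (trans (+-identityʳ (weight (m + 0))) (cong weight (+-identityʳ m)))

freeCount : (ℕ → Bool) → ℕ → ℕ → ℕ
freeCount c i zero      = 0
freeCount c i (suc len) = if c i then freeCount c (suc i) len else suc (freeCount c (suc i) len)

freeCount≤ : ∀ c i len → freeCount c i len ≤ len
freeCount≤ c i zero = z≤n
freeCount≤ c i (suc len) with c i
... | true  = m≤n⇒m≤1+n (freeCount≤ c (suc i) len)
... | false = s≤s (freeCount≤ c (suc i) len)

_⊆ᵇ_ : (ℕ → Bool) → (ℕ → Bool) → Set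
c ⊆ᵇ c′ = ∀ {j} → c j ≡ true → c′ j ≡ true

freeCount-anti : ∀ {c c′} → c ⊆ᵇ c′ → ∀ i len → freeCount c′ i len ≤ freeCount c i len
freeCount-anti c⊆c′ i zero = z≤n
freeCount-anti {c} {c′} c⊆c′ i (suc len) with c i in e | c′ i in e′
... | true  | true  = freeCount-anti c⊆c′ (suc i) len
... | true  | false = ⊥-elim (≡true⇒≢false (c⊆c′ e) e′)
... | false | true  = m≤n⇒m≤1+n (freeCount-anti c⊆c′ (suc i) len)
... | false | false = s≤s (freeCount-anti c⊆c′ (suc i) len)

freeCount-strict : ∀ {c c′} → c ⊆ᵇ c′ → ∀ {i len y} → i ≤ y → y < i + len → c y ≡ false → c′ y ≡ true →
                   freeCount c′ i len < freeCount c i len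
freeCount-strict c⊆c′ {i} {zero} i≤y y<i+0 _ _ = ⊥-elim (empty-interval i≤y y<i+0)
freeCount-strict {c} {c′} c⊆c′ {i} {suc len} {y} i≤y y<end cy c′y with m≤n⇒m<n∨m≡n i≤y
... | inj₂ refl rewrite cy | c′y = s≤s (freeCount-anti c⊆c′ (suc i) len)
... | inj₁ i<y with c i in e | c′ i in e′
...   | true  | true  = freeCount-strict c⊆c′ i<y (subst (y <_) (+-suc i len) y<end) cy c′y
...   | true  | false = ⊥-elim (≡true⇒≢false (c⊆c′ e) e′)
...   | false | true  = s≤s (freeCount-anti c⊆c′ (suc i) len)
...   | false | false = s≤s (freeCount-strict c⊆c′ i<y (subst (y <_) (+-suc i len) y<end) cy c′y)

freeCount-pos : ∀ c {i len y} → i ≤ y → y < i + len → c y ≡ false → 0 < freeCount c i len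
freeCount-pos c {i} {zero} i≤y y<i+0 _ = ⊥-elim (empty-interval i≤y y<i+0)
freeCount-pos c {i} {suc len} {y} i≤y y<end cy with c i in e
... | false = z<s
... | true with m≤n⇒m<n∨m≡n i≤y
...   | inj₂ refl = ⊥-elim (≡true⇒≢false e cy)
...   | inj₁ i<y  = freeCount-pos c i<y (subst (y <_) (+-suc i len) y<end) cy

LeftClosed : (ℕ → Bool) → ℕ → Set
LeftClosed c p = p ≡ 0 ⊎ ∃[ p′ ] p ≡ suc p′ × c p′ ≡ true

record Run (c : ℕ → Bool) (n p m : ℕ) : Set where
  field
    fits    : p + m ≤ n
    free    : Free c p m
    closedˡ : LeftClosed c p
    closedʳ : p + m ≡ n ⊎ (p + m < n × c (p + m) ≡ true)
open Run public

Free-extend : ∀ {c s acc} → Free c s acc → c (s + acc) ≡ false → Free c s (suc acc)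
Free-extend {c} {s} {acc} free cs+acc {j} s≤j j<end with m≤n⇒m<n∨m≡n (subst (j <_) (+-suc s acc) j<end)
... | inj₁ j<s+acc = free s≤j (≤-pred j<s+acc)
... | inj₂ refl    = cs+acc

run-of-∈′ : ∀ {c n m} len s acc → Free c s acc → LeftClosed c s → s + acc + len ≡ n →
            m ∈ runs c (s + acc) len acc → ∃[ p ] Run c n p m
run-of-∈′ {n = n} zero s acc free closed end (here refl) =
  s , record { fits = ≤-reflexive s+acc≡n ; free = free ; closedˡ = closed ; closedʳ = inj₁ s+acc≡n }
  where
  s+acc≡n : s + acc ≡ n
  s+acc≡n = trans (sym (+-identityʳ _)) end
run-of-∈′ {c} (suc len) s acc free closed end m∈ with c (s + acc) in e
run-of-∈′ (suc len) s acc free closed end (here refl) | true =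
  s , record { fits = subst (s + acc ≤_) end (m≤m+n (s + acc) (suc len)) ; free = free ; closedˡ = closed
             ; closedʳ = inj₂ (subst (s + acc <_) end (m<m+n (s + acc) z<s) , e) }
run-of-∈′ {c} {m = m} (suc len) s acc free closed end (there m∈) | true =
  run-of-∈′ len (suc (s + acc)) 0 (Within-empty {λ j → c j ≡ false})
    (inj₂ (s + acc , refl , e))
    (trans (cong (_+ len) (+-identityʳ (suc (s + acc)))) (trans (sym (+-suc (s + acc) len)) end))
    (subst (λ k → m ∈ runs c k len 0) (sym (+-identityʳ _)) m∈)
run-of-∈′ {c} {m = m} (suc len) s acc free closed end m∈ | false =
  run-of-∈′ len s (suc acc) (Free-extend free e) closed
    (trans (cong (_+ len) (+-suc s acc)) (trans (sym (+-suc (s + acc) len)) end))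
    (subst (λ k → m ∈ runs c k len (suc acc)) (sym (+-suc s acc)) m∈)

run-of-∈ : ∀ {c n m} → m ∈ runs c 0 n 0 → ∃[ p ] Run c n p m
run-of-∈ {c} {n} = run-of-∈′ n 0 0 (Within-empty {λ j → c j ≡ false}) (inj₁ refl) refl

runStart : (ℕ → Bool) → ℕ → ℕ
runStart c zero    = zero
runStart c (suc y) = if c y then suc y else runStart c y

runStart≤ : ∀ c y → runStart c y ≤ y
runStart≤ c zero = z≤n
runStart≤ c (suc y) with c y
... | true  = ≤-refl
... | false = m≤n⇒m≤1+n (runStart≤ c y)

runStart-free : ∀ c y {j} → runStart c y ≤ j → j < y → c j ≡ false
runStart-free c (suc y) {j} start≤j j<1+y with c y in e
... | true  = ⊥-elim (1+n≰n (≤-trans j<1+y start≤j))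
... | false with m≤n⇒m<n∨m≡n (≤-pred j<1+y)
...   | inj₁ j<y  = runStart-free c y start≤j j<y
...   | inj₂ refl = e

runStart-closed : ∀ c y → LeftClosed c (runStart c y)
runStart-closed c zero = inj₁ refl
runStart-closed c (suc y) with c y in e
... | true  = inj₂ (y , refl , e)
... | false = runStart-closed c y

runEnd : (ℕ → Bool) → ℕ → ℕ → ℕ
runEnd c y zero    = y
runEnd c y (suc k) = if c y then y else runEnd c (suc y) k

runEnd≥ : ∀ c y k → y ≤ runEnd c y k
runEnd≥ c y zero = ≤-refl
runEnd≥ c y (suc k) with c y
... | true  = ≤-refl
... | false = ≤-trans (n≤1+n y) (runEnd≥ c (suc y) k)

runEnd-free : ∀ c y k {j} → y ≤ j → j < runEnd c y k → c j ≡ false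
runEnd-free c y zero    y≤j j<y = ⊥-elim (1+n≰n (≤-trans j<y y≤j))
runEnd-free c y (suc k) y≤j j<end with c y in e
... | true  = ⊥-elim (1+n≰n (≤-trans j<end y≤j))
... | false with m≤n⇒m<n∨m≡n y≤j
...   | inj₁ y<j  = runEnd-free c (suc y) k y<j j<end
...   | inj₂ refl = e

runEnd-closed : ∀ c y k → runEnd c y k ≡ y + k ⊎ (runEnd c y k < y + k × c (runEnd c y k) ≡ true)
runEnd-closed c y zero = inj₁ (sym (+-identityʳ y))
runEnd-closed c y (suc k) with c y in e
... | true  = inj₂ (m<m+n y z<s , e)
... | false with runEnd-closed c (suc y) k
...   | inj₁ end≡    = inj₁ (trans end≡ (sym (+-suc y k)))
...   | inj₂ (lt , t) = inj₂ (subst (runEnd c (suc y) k <_) (sym (+-suc y k)) lt , t)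

run-containing : ∀ c {n y} → y < n → c y ≡ false → ∃₂ λ p m → Run c n p m × p ≤ y × y < p + m
run-containing c {n} {y} y<n cy = p , e ∸ p , run , runStart≤ c y , subst (y <_) (sym p+m≡e) y<e
  where
  p e : ℕ
  p = runStart c y
  e = runEnd c y (n ∸ y)
  y+k≡n : y + (n ∸ y) ≡ n
  y+k≡n = m+[n∸m]≡n (<⇒≤ y<n)
  p+m≡e : p + (e ∸ p) ≡ e
  p+m≡e = m+[n∸m]≡n (≤-trans (runStart≤ c y) (runEnd≥ c y (n ∸ y)))
  e≤n : e ≤ n
  e≤n with runEnd-closed c y (n ∸ y)
  ... | inj₁ e≡    = ≤-reflexive (trans e≡ y+k≡n)
  ... | inj₂ (e< , _) = subst (e ≤_) y+k≡n (<⇒≤ e<)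
  y<e : y < e
  y<e with m≤n⇒m<n∨m≡n (runEnd≥ c y (n ∸ y)) | runEnd-closed c y (n ∸ y)
  ... | inj₁ y<e  | _            = y<e
  ... | inj₂ y≡e | inj₁ e≡      = ⊥-elim (<-irrefl (trans y≡e (trans e≡ y+k≡n)) y<n)
  ... | inj₂ y≡e | inj₂ (_ , ce) = ⊥-elim (≡true⇒≢false (subst (λ k → c k ≡ true) (sym y≡e) ce) cy)
  free-around-y : ∀ {j} → p ≤ j → j < e → c j ≡ false
  free-around-y {j} p≤j j<e with <-≤-connex j y
  ... | inj₁ j<y = runStart-free c y p≤j j<y
  ... | inj₂ y≤j = runEnd-free c y (n ∸ y) y≤j j<e
  run : Run c n p (e ∸ p)
  run = record
    { fits    = subst (_≤ n) (sym p+m≡e) e≤n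
    ; free    = λ p≤j j<p+m → free-around-y p≤j (subst (_ <_) p+m≡e j<p+m)
    ; closedˡ = runStart-closed c y
    ; closedʳ = closedʳ′
    }
    where
    closedʳ′ : p + (e ∸ p) ≡ n ⊎ (p + (e ∸ p) < n × c (p + (e ∸ p)) ≡ true)
    closedʳ′ rewrite p+m≡e with runEnd-closed c y (n ∸ y)
    ... | inj₁ e≡         = inj₁ (trans e≡ y+k≡n)
    ... | inj₂ (e< , ce)  = inj₂ (subst (e <_) y+k≡n e< , ce)

AgreeOutside : (ℕ → Bool) → (ℕ → Bool) → ℕ → ℕ → ℕ → Set
AgreeOutside c c′ n p m = ∀ {j} → j < n → j < p ⊎ p + m ≤ j → c′ j ≡ c j

weightSum-right-of-run : ∀ {c p m r} → r ≡ 0 ⊎ c (p + m) ≡ true → ∃[ K ] ∀ {c′} →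
  Within (λ j → c′ j ≡ c j) (p + m) r → weightSum (runs c′ p (m + r) 0) ≡ weightSum (runs c′ p m 0) + K
weightSum-right-of-run {p = p} {m} {zero} _ =
  0 , λ {c′} _ → trans (cong (λ k → weightSum (runs c′ p k 0)) (+-identityʳ m)) (sym (+-identityʳ _))
weightSum-right-of-run {p = p} {m} {suc r} (inj₁ ())
weightSum-right-of-run {c} {p} {m} {suc r} (inj₂ c[p+m]) = weightSum (runs c (suc (p + m)) r 0) , λ {c′} agree → begin
  weightSum (runs c′ p (m + suc r) 0)
    ≡⟨ cong weightSum (runs-split {c′} {p} {m} {r} {0} (trans (Within-head agree) c[p+m])) ⟩
  weightSum (runs c′ p m 0 ++ runs c′ (suc (p + m)) r 0)
    ≡⟨ weightSum-++ (runs c′ p m 0) _ ⟩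
  weightSum (runs c′ p m 0) + weightSum (runs c′ (suc (p + m)) r 0)
    ≡⟨ cong (λ rs → weightSum (runs c′ p m 0) + weightSum rs) (runs-cong (Within-tail agree)) ⟩
  weightSum (runs c′ p m 0) + weightSum (runs c (suc (p + m)) r 0) ∎
  where open ≡-Reasoning

weightSum-left-of-run : ∀ {c c′ p′ m} → c p′ ≡ true → Within (λ j → c′ j ≡ c j) 0 (suc p′) →
  weightSum (runs c′ 0 (suc p′ + m) 0) ≡ weightSum (runs c 0 p′ 0) + weightSum (runs c′ (suc p′) m 0)
weightSum-left-of-run {c} {c′} {p′} {m} c[p′] agree = begin
  weightSum (runs c′ 0 (suc p′ + m) 0)
    ≡⟨ cong (λ k → weightSum (runs c′ 0 k 0)) (sym (+-suc p′ m)) ⟩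
  weightSum (runs c′ 0 (p′ + suc m) 0)
    ≡⟨ cong weightSum (runs-split {c′} {0} {p′} {m} {0} (trans (agree z≤n ≤-refl) c[p′])) ⟩
  weightSum (runs c′ 0 p′ 0 ++ runs c′ (suc p′) m 0)
    ≡⟨ weightSum-++ (runs c′ 0 p′ 0) _ ⟩
  weightSum (runs c′ 0 p′ 0) + weightSum (runs c′ (suc p′) m 0)
    ≡⟨ cong (λ rs → weightSum rs + weightSum (runs c′ (suc p′) m 0))
            (runs-cong {c′} {c} {0} {p′} {0} λ _ j<p′ → agree z≤n (m<n⇒m<1+n j<p′)) ⟩
  weightSum (runs c 0 p′ 0) + weightSum (runs c′ (suc p′) m 0) ∎
  where open ≡-Reasoning

potential-around-run : ∀ {c n p m} → Run c n p m →
  ∃[ K ] ∀ {c′} → AgreeOutside c c′ n p m → potential c′ n ≡ K + weightSum (runs c′ p m 0)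
potential-around-run {c} {n} {p} {m} run = around (closedˡ run)
  where
  r : ℕ
  r = n ∸ (p + m)
  p+m+r≡n : p + m + r ≡ n
  p+m+r≡n = m+[n∸m]≡n (fits run)
  potential≡ : ∀ c′ → potential c′ n ≡ weightSum (runs c′ 0 (p + (m + r)) 0)
  potential≡ c′ =
    trans (potential-runs c′ n) (cong (λ k → weightSum (runs c′ 0 k 0)) (trans (sym p+m+r≡n) (+-assoc p m r)))
  closed-right : r ≡ 0 ⊎ c (p + m) ≡ true
  closed-right with closedʳ run
  ... | inj₁ p+m≡n         = inj₁ (trans (cong (n ∸_) p+m≡n) (n∸n≡0 n))
  ... | inj₂ (_ , c[p+m]) = inj₂ c[p+m]
  K : ℕ
  K = proj₁ (weightSum-right-of-run {c} {p} {m} {r} closed-right)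
  right : ∀ {c′} → AgreeOutside c c′ n p m → weightSum (runs c′ p (m + r) 0) ≡ weightSum (runs c′ p m 0) + K
  right agree = proj₂ (weightSum-right-of-run {c} {p} {m} {r} closed-right)
                      λ {j} p+m≤j j<end → agree (subst (j <_) p+m+r≡n j<end) (inj₂ p+m≤j)
  around : LeftClosed c p → ∃[ K′ ] ∀ {c′} → AgreeOutside c c′ n p m → potential c′ n ≡ K′ + weightSum (runs c′ p m 0)
  around (inj₁ refl) = K , λ {c′} agree → trans (potential≡ c′) (trans (right agree) (+-comm _ K))
  around (inj₂ (p′ , refl , c[p′])) = L + K , λ {c′} agree → begin
    potential c′ n                                      ≡⟨ potential≡ c′ ⟩
    weightSum (runs c′ 0 (suc p′ + (m + r)) 0)          ≡⟨ weightSum-left-of-run c[p′] (left agree) ⟩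
    L + weightSum (runs c′ (suc p′) (m + r) 0)          ≡⟨ cong (L +_) (trans (right agree) (+-comm _ K)) ⟩
    L + (K + weightSum (runs c′ (suc p′) m 0))          ≡⟨ sym (+-assoc L K _) ⟩
    L + K + weightSum (runs c′ (suc p′) m 0)            ∎
    where
    open ≡-Reasoning
    L : ℕ
    L = weightSum (runs c 0 p′ 0)
    left : ∀ {c′} → AgreeOutside c c′ n (suc p′) m → Within (λ j → c′ j ≡ c j) 0 (suc p′)
    left agree _ j<1+p′ = agree (<-≤-trans j<1+p′ (≤-trans (m≤m+n (suc p′) m) (fits run))) (inj₁ j<1+p′)

weightSum-play-at-start : ∀ x t → weightSum (runs N[ x ] x t 0) ≡ weight (t ∸ 2)
weightSum-play-at-start x zero                 = refl
weightSum-play-at-start x (suc zero)          rewrite N[]-self x = refl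
weightSum-play-at-start x (suc (suc t))       rewrite N[]-self x | N[]-suc x =
  weightSum-free {N[ x ]} {2 + x} {t} λ 2+x≤j _ → N[]-far (inj₂ 2+x≤j)

weightSum-play-inside : ∀ p i t → weightSum (runs N[ p + i ] p (i + t) 0) ≡ weight (i ∸ 1) + weight (t ∸ 2)
weightSum-play-inside p zero    t rewrite +-identityʳ p = weightSum-play-at-start p t
weightSum-play-inside p (suc a) t = begin
  weightSum (runs N[ x ] p (suc a + t) 0)
    ≡⟨ cong (λ k → weightSum (runs N[ x ] p k 0)) (sym (+-suc a t)) ⟩
  weightSum (runs N[ x ] p (a + suc t) 0)
    ≡⟨ cong weightSum (runs-split {N[ x ]} {p} {a} {t} {0} (N[]-pred-at)) ⟩
  weightSum (runs N[ x ] p a 0 ++ runs N[ x ] (suc (p + a)) t 0)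
    ≡⟨ weightSum-++ (runs N[ x ] p a 0) _ ⟩
  weightSum (runs N[ x ] p a 0) + weightSum (runs N[ x ] (suc (p + a)) t 0)
    ≡⟨ cong₂ _+_
         (weightSum-free {N[ x ]} {p} {a} λ {j} _ j<p+a → N[]-far (inj₁ (subst (2 + j ≤_) (sym (+-suc p a)) (s≤s j<p+a))))
         (trans (cong (λ k → weightSum (runs N[ x ] k t 0)) (sym (+-suc p a))) (weightSum-play-at-start x t)) ⟩
  weight a + weight (t ∸ 2) ∎
  where
  open ≡-Reasoning
  x : ℕ
  x = p + suc a
  N[]-pred-at : N[ x ] (p + a) ≡ true
  N[]-pred-at = subst (λ k → N[ k ] (p + a) ≡ true) (sym (+-suc p a)) (N[]-pred (p + a))

weightSum-play-before : ∀ x m → weightSum (runs N[ x ] (suc x) m 0) ≡ weight (m ∸ 1)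
weightSum-play-before x zero    = refl
weightSum-play-before x (suc m) rewrite N[]-suc x =
  weightSum-free {N[ x ]} {2 + x} {m} λ 2+x≤j _ → N[]-far (inj₂ 2+x≤j)

weightSum-play-after : ∀ p m → weightSum (runs N[ p + m ] p m 0) ≡ weight (m ∸ 1)
weightSum-play-after p m =
  trans (cong (λ k → weightSum (runs N[ p + m ] p k 0)) (sym (+-identityʳ m)))
        (trans (weightSum-play-inside p m 0) (+-identityʳ _))

Run-closedˡ : ∀ {c n p m j} → Run c n p m → suc j ≡ p → c j ≡ true
Run-closedˡ {c} run 1+j≡p with closedˡ run
... | inj₁ p≡0                 = ⊥-elim (0≢1+n (trans (sym p≡0) (sym 1+j≡p)))
... | inj₂ (p′ , p≡1+p′ , cp′) = subst (λ k → c k ≡ true) (suc-injective (trans (sym p≡1+p′) (sym 1+j≡p))) cp′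

Run-closedʳ : ∀ {c n p m} → Run c n p m → p + m < n → c (p + m) ≡ true
Run-closedʳ run p+m<n with closedʳ run
... | inj₁ p+m≡n      = ⊥-elim (<-irrefl p+m≡n p+m<n)
... | inj₂ (_ , cp+m) = cp+m

Run-neighbour : ∀ {c n p m y j} → Run c n p m → p ≤ y → y < p + m → suc j ≡ y ⊎ suc y ≡ j → j < n → c j ≡ false →
                p ≤ j × j < p + m
Run-neighbour {c} {p = p} {j = j} run p≤y y<p+m (inj₁ refl) j<n cj = p≤j , ≤-trans (n≤1+n _) y<p+m
  where
  p≤j : p ≤ j
  p≤j with <-≤-connex j p
  ... | inj₂ p≤j = p≤j
  ... | inj₁ j<p = ⊥-elim (≡true⇒≢false (Run-closedˡ run (≤-antisym j<p p≤y)) cj)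
Run-neighbour {c} {n} {p} {m} {y} run p≤y y<p+m (inj₂ refl) j<n cj = ≤-trans p≤y (n≤1+n y) , 1+y<p+m
  where
  1+y<p+m : suc y < p + m
  1+y<p+m with <-≤-connex (suc y) (p + m)
  ... | inj₁ lt = lt
  ... | inj₂ p+m≤1+y = ⊥-elim (≡true⇒≢false (subst (λ k → c k ≡ true) (sym 1+y≡p+m)
                                              (Run-closedʳ run (subst (_< n) 1+y≡p+m j<n))) cj)
    where
    1+y≡p+m : suc y ≡ p + m
    1+y≡p+m = ≤-antisym y<p+m p+m≤1+y

any-true⁻ : ∀ {A : Set} (f : A → Bool) xs → any f xs ≡ true → ∃[ x ] x ∈ xs × f x ≡ true
any-true⁻ f (x ∷ xs) e with f x in fx
... | true  = x , here refl , fx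
... | false with any-true⁻ f xs e
...   | y , y∈xs , fy = y , there y∈xs , fy

any-true⁺ : ∀ {A : Set} (f : A → Bool) {xs x} → x ∈ xs → f x ≡ true → any f xs ≡ true
any-true⁺ f {x ∷ xs} (here refl)  fx = ∨-trueˡ (any f xs) fx
any-true⁺ f {x ∷ xs} (there x∈xs) fx = ∨-trueʳ (f x) (any-true⁺ f x∈xs fx)

-- dominatedBy S (toℕ v) is inClosedNbhd (Path n) S v by definition.
dominatedBy : ∀ {n} → List (Fin n) → ℕ → Bool
dominatedBy S j = any (λ s → N[ toℕ s ] j) S

-- Ensures that playing a dominated vertex next to a run changes no other run.
record WellDominated (n : ℕ) (c : ℕ → Bool) : Set where
  field
    guardedˡ : ∀ {w} → c w ≡ true → c (suc w) ≡ false → ∃[ w′ ] w ≡ suc w′ × c w′ ≡ true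
    guardedʳ : ∀ {w} → c (suc w) ≡ true → c w ≡ false → suc (suc w) < n × c (suc (suc w)) ≡ true
open WellDominated public

dominatedBy-wellDominated : ∀ {n} (S : List (Fin n)) → WellDominated n (dominatedBy S)
dominatedBy-wellDominated {n} S = record { guardedˡ = guardedˡ′ ; guardedʳ = guardedʳ′ }
  where
  dominates : ∀ {s j} → s ∈ S → N[ toℕ s ] j ≡ true → dominatedBy S j ≡ true
  dominates {j = j} s∈S = any-true⁺ (λ s′ → N[ toℕ s′ ] j) s∈S
  guardedˡ′ : ∀ {w} → dominatedBy S w ≡ true → dominatedBy S (suc w) ≡ false →
              ∃[ w′ ] w ≡ suc w′ × dominatedBy S w′ ≡ true
  guardedˡ′ {w} cw c[1+w] with any-true⁻ _ S cw
  ... | s , s∈S , N[s]w with N[]-true⁻ {toℕ s} N[s]w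
  ...   | inj₁ refl          = ⊥-elim (≡true⇒≢false (dominates s∈S (N[]-suc w)) c[1+w])
  ...   | inj₂ (inj₁ refl)   = toℕ s , refl , dominates s∈S (N[]-self (toℕ s))
  ...   | inj₂ (inj₂ 1+w≡s)  =
    ⊥-elim (≡true⇒≢false (dominates s∈S (subst (λ k → N[ k ] (suc w) ≡ true) 1+w≡s (N[]-self (suc w)))) c[1+w])
  guardedʳ′ : ∀ {w} → dominatedBy S (suc w) ≡ true → dominatedBy S w ≡ false →
              suc (suc w) < n × dominatedBy S (suc (suc w)) ≡ true
  guardedʳ′ {w} c[1+w] cw with any-true⁻ _ S c[1+w]
  ... | s , s∈S , N[s][1+w] with N[]-true⁻ {toℕ s} N[s][1+w]
  ...   | inj₁ s≡1+w          =
    ⊥-elim (≡true⇒≢false (dominates s∈S (subst (λ k → N[ k ] w ≡ true) (sym s≡1+w) (N[]-pred w))) cw)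
  ...   | inj₂ (inj₁ 1+s≡1+w) =
    ⊥-elim (≡true⇒≢false (dominates s∈S (subst (λ k → N[ k ] w ≡ true) (sym (suc-injective 1+s≡1+w)) (N[]-self w)))
                          cw)
  ...   | inj₂ (inj₂ 2+w≡s)   =
    subst (_< n) (sym 2+w≡s) (toℕ<n s) ,
    dominates s∈S (subst (λ k → N[ k ] (suc (suc w)) ≡ true) 2+w≡s (N[]-self (suc (suc w))))

ChangesRun : ℕ → (ℕ → Bool) → ℕ → ℕ → ℕ → Set
ChangesRun n c x m V = ∃[ K ] potential c n ≡ K + weight m × potential (play x c) n ≡ K + V

ChangesRun⇒Drop : ∀ {n c x m V} → ChangesRun n c x m V → Drop (weight m) V →
                  Drop (potential c n) (potential (play x c) n)
ChangesRun⇒Drop (K , before , after) drop = subst₂ Drop (sym before) (sym after) (Drop-+ˡ K drop)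

ChangesRun-+≤ : ∀ {n c x m V e} → ChangesRun n c x m V → V + e ≤ weight m → potential (play x c) n + e ≤ potential c n
ChangesRun-+≤ {n} {c} {x} {m} {V} {e} (K , before , after) h = begin
  potential (play x c) n + e  ≡⟨ cong (_+ e) after ⟩
  K + V + e                   ≡⟨ +-assoc K V e ⟩
  K + (V + e)                 ≤⟨ +-monoʳ-≤ K h ⟩
  K + weight m                ≡⟨ sym before ⟩
  potential c n               ∎
  where open ≤-Reasoning

ChangesRun-≤+ : ∀ {n c x m V e} → ChangesRun n c x m V → weight m ≤ V + e → potential c n ≤ potential (play x c) n + e
ChangesRun-≤+ {n} {c} {x} {m} {V} {e} (K , before , after) h = begin
  potential c n               ≡⟨ before ⟩
  K + weight m                ≤⟨ +-monoʳ-≤ K h ⟩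
  K + (V + e)                 ≡⟨ sym (+-assoc K V e) ⟩
  K + V + e                   ≡⟨ cong (_+ e) (sym after) ⟩
  potential (play x c) n + e  ∎
  where open ≤-Reasoning

changes-run : ∀ {c n p m x} → Run c n p m → AgreeOutside c (play x c) n p m →
              ChangesRun n c x m (weightSum (runs N[ x ] p m 0))
changes-run {c} {n} {p} {m} {x} run agree with potential-around-run run
... | K , around = K , trans (around (λ _ _ → refl)) (cong (K +_) (weightSum-free (free run)))
                     , trans (around agree) (cong (λ rs → K + weightSum rs) (runs-cong inside))
  where
  inside : Within (λ j → play x c j ≡ N[ x ] j) p m
  inside {j} p≤j j<p+m = trans (cong (N[ x ] j ∨_) (free run p≤j j<p+m)) (∨-identityʳ (N[ x ] j))

agree-if-unreached : ∀ {c n p m} x → (∀ {j} → j < n → j < p ⊎ p + m ≤ j → c j ≡ false → N[ x ] j ≡ true → ⊥) →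
                     AgreeOutside c (play x c) n p m
agree-if-unreached {c} x unreached {j} j<n outside with c j in cj
... | true  = ∨-zeroʳ (N[ x ] j)
... | false with N[ x ] j in N[x]j
...   | false = refl
...   | true  = ⊥-elim (unreached j<n outside cj N[x]j)

play-inside : ∀ {c n p m} → Run c n p m → ∀ i {t} → m ≡ i + t → 1 ≤ t →
              ChangesRun n c (p + i) m (weight (i ∸ 1) + weight (t ∸ 2))
play-inside {c} {n} {p} {m} run i {t} m≡i+t 1≤t =
  subst (ChangesRun n c x m) (trans (cong (λ k → weightSum (runs N[ x ] p k 0)) m≡i+t) (weightSum-play-inside p i t))
        (changes-run {x = x} run (agree-if-unreached x unreached))
  where
  x : ℕ
  x = p + i
  x<p+m : x < p + m
  x<p+m = +-monoʳ-< p (subst (i <_) (sym m≡i+t) (m<m+n i 1≤t))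
  unreached : ∀ {j} → j < n → j < p ⊎ p + m ≤ j → c j ≡ false → N[ x ] j ≡ true → ⊥
  unreached {j} j<n outside cj N[x]j with N[]-true⁻ {x} N[x]j | outside
  ... | inj₁ refl        | inj₁ j<p   = 1+n≰n (≤-trans j<p (m≤m+n p i))
  ... | inj₁ refl        | inj₂ p+m≤j = 1+n≰n (≤-trans x<p+m p+m≤j)
  ... | inj₂ (inj₁ refl) | inj₁ j<p   = 1+n≰n (≤-trans (m≤n⇒m≤1+n (s≤s (m≤m+n p i))) j<p)
  ... | inj₂ (inj₁ refl) | inj₂ p+m≤j =
    ≡true⇒≢false (subst (λ k → c k ≡ true) (sym (≤-antisym x<p+m p+m≤j)) (Run-closedʳ run (≤-<-trans p+m≤j j<n))) cj
  ... | inj₂ (inj₂ 1+j≡x) | inj₁ j<p   =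
    ≡true⇒≢false (Run-closedˡ run (≤-antisym j<p (subst (p ≤_) (sym 1+j≡x) (m≤m+n p i)))) cj
  ... | inj₂ (inj₂ 1+j≡x) | inj₂ p+m≤j = 1+n≰n (≤-trans x<p+m (≤-trans p+m≤j (subst (j ≤_) 1+j≡x (n≤1+n j))))

play-before : ∀ {c n x m} → WellDominated n c → Run c n (suc x) m → 1 ≤ m → ChangesRun n c x m (weight (m ∸ 1))
play-before {c} {n} {x} {m} wd run 1≤m =
  subst (ChangesRun n c x m) (weightSum-play-before x m) (changes-run {x = x} run (agree-if-unreached x unreached))
  where
  cx : c x ≡ true
  cx = Run-closedˡ run refl
  c[1+x] : c (suc x) ≡ false
  c[1+x] = free run ≤-refl (m<m+n (suc x) 1≤m)
  unreached : ∀ {j} → j < n → j < suc x ⊎ suc x + m ≤ j → c j ≡ false → N[ x ] j ≡ true → ⊥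
  unreached {j} j<n outside cj N[x]j with N[]-true⁻ {x} N[x]j | outside
  ... | inj₁ refl        | _          = ≡true⇒≢false cx cj
  ... | inj₂ (inj₁ refl) | inj₁ j<j   = 1+n≰n j<j
  ... | inj₂ (inj₁ refl) | inj₂ end≤j = 1+n≰n (≤-trans (m<m+n (suc x) 1≤m) end≤j)
  ... | inj₂ (inj₂ refl) | _ with guardedˡ wd cx c[1+x]
  ...   | w′ , 1+j≡1+w′ , cw′ = ≡true⇒≢false (subst (λ k → c k ≡ true) (sym (suc-injective 1+j≡1+w′)) cw′) cj

play-after : ∀ {c n p m} → WellDominated n c → Run c n p m → 1 ≤ m → p + m < n →
             ChangesRun n c (p + m) m (weight (m ∸ 1))
play-after {c} {n} {p} {suc m′} wd run _ end<n =
  subst (ChangesRun n c x (suc m′)) (weightSum-play-after p (suc m′))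
        (changes-run {x = x} run (agree-if-unreached x unreached))
  where
  x : ℕ
  x = p + suc m′
  1+[p+m′]≡x : suc (p + m′) ≡ x
  1+[p+m′]≡x = sym (+-suc p m′)
  cx : c x ≡ true
  cx = Run-closedʳ run end<n
  c[1+p+m′] : c (suc (p + m′)) ≡ true
  c[1+p+m′] = subst (λ k → c k ≡ true) (sym 1+[p+m′]≡x) cx
  c[p+m′] : c (p + m′) ≡ false
  c[p+m′] = free run (m≤m+n p m′) (subst (p + m′ <_) 1+[p+m′]≡x ≤-refl)
  unreached : ∀ {j} → j < n → j < p ⊎ x ≤ j → c j ≡ false → N[ x ] j ≡ true → ⊥
  unreached {j} j<n outside cj N[x]j with N[]-true⁻ {x} N[x]j | outside
  ... | inj₁ refl         | _        = ≡true⇒≢false cx cj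
  ... | inj₂ (inj₁ refl)  | _        =
    ≡true⇒≢false (subst (λ k → c (suc k) ≡ true) 1+[p+m′]≡x (proj₂ (guardedʳ wd c[1+p+m′] c[p+m′]))) cj
  ... | inj₂ (inj₂ 1+j≡x) | inj₁ j<p =
    <⇒≱ j<p (subst (p ≤_) (suc-injective (trans 1+[p+m′]≡x (sym 1+j≡x))) (m≤m+n p m′))
  ... | inj₂ (inj₂ 1+j≡x) | inj₂ x≤j = 1+n≰n (≤-trans (≤-reflexive 1+j≡x) x≤j)

record LegalMove (n : ℕ) (c : ℕ → Bool) (x : ℕ) : Set where
  field
    target partner : ℕ
    target<n       : target < n
    partner<n      : partner < n
    target-free    : c target ≡ false
    partner-free   : c partner ≡ false
    adjacent       : suc target ≡ partner ⊎ suc partner ≡ target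
    reaches-target : N[ x ] target ≡ true
open LegalMove public

legal-in-run : ∀ {c n p m x} → Run c n p m → ∀ {y z} → p ≤ y → y < p + m → p ≤ z → z < p + m →
               suc y ≡ z ⊎ suc z ≡ y → N[ x ] y ≡ true → LegalMove n c x
legal-in-run run {y} {z} p≤y y<end p≤z z<end y~z N[x]y = record
  { target = y ; partner = z ; target<n = <-≤-trans y<end (fits run) ; partner<n = <-≤-trans z<end (fits run)
  ; target-free = free run p≤y y<end ; partner-free = free run p≤z z<end ; adjacent = y~z ; reaches-target = N[x]y }

position-near-run : ∀ {p m x y} → p ≤ y → y < p + m → x ≡ y ⊎ suc x ≡ y ⊎ suc y ≡ x →
                    (p ≤ x × x < p + m) ⊎ suc x ≡ p ⊎ x ≡ p + m
position-near-run p≤y y<end (inj₁ refl) = inj₁ (p≤y , y<end)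
position-near-run {p} {x = x} p≤y y<end (inj₂ (inj₁ refl)) with p ≤? x
... | yes p≤x = inj₁ (p≤x , <-trans (n<1+n x) y<end)
... | no  p≰x = inj₂ (inj₁ (≤-antisym (≰⇒> p≰x) p≤y))
position-near-run {p} {m} {x} p≤y y<end (inj₂ (inj₂ refl)) with x <? p + m
... | yes x<end = inj₁ (≤-trans p≤y (n≤1+n _) , x<end)
... | no  x≮end = inj₂ (inj₂ (≤-antisym y<end (≮⇒≥ x≮end)))

run-length≥2 : ∀ {c n p m x} → Run c n p m → (L : LegalMove n c x) → p ≤ target L → target L < p + m → 2 ≤ m
run-length≥2 {p = p} {m} run L p≤y y<end
  with Run-neighbour run p≤y y<end (swap (adjacent L)) (partner<n L) (partner-free L) | adjacent L
... | _ , z<end   | inj₁ refl = +-cancelˡ-≤ p 2 m (subst (_≤ p + m) (+-comm 2 p) (≤-trans (s≤s (s≤s p≤y)) z<end))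
... | p≤z , _     | inj₂ refl = +-cancelˡ-≤ p 2 m (subst (_≤ p + m) (+-comm 2 p) (≤-trans (s≤s (s≤s p≤z)) y<end))

split-at : ∀ {p m x} → p ≤ x → x < p + m → ∃₂ λ i t → x ≡ p + i × m ≡ i + t × 1 ≤ t
split-at {p} {m} {x} p≤x x<end = x ∸ p , m ∸ (x ∸ p) , sym (m+[n∸m]≡n p≤x) , sym (m+[n∸m]≡n (<⇒≤ i<m)) , m<n⇒0<n∸m i<m
  where
  i<m : x ∸ p < m
  i<m = +-cancelˡ-< p (x ∸ p) m (subst (_< p + m) (sym (m+[n∸m]≡n p≤x)) x<end)

drop-near-run : ∀ {c n p m x} → WellDominated n c → x < n → Run c n p m → 2 ≤ m →
                (p ≤ x × x < p + m) ⊎ suc x ≡ p ⊎ x ≡ p + m → Drop (potential c n) (potential (play x c) n)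
drop-near-run {c} {n} {p} wd x<n run 2≤m (inj₁ (p≤x , x<end)) with split-at p≤x x<end
... | i , t , refl , refl , 1≤t =
  ChangesRun⇒Drop {n} {c} {p + i} {i + t} (play-inside run i refl 1≤t) (weight-drop-split i t 1≤t 2≤m)
drop-near-run {c} {n} {m = m} {x} wd x<n run 2≤m (inj₂ (inj₁ refl)) =
  ChangesRun⇒Drop {n} {c} {x} {m} (play-before wd run (<⇒≤ 2≤m)) (weight-drop-end m 2≤m)
drop-near-run {c} {n} {p} {m} wd x<n run 2≤m (inj₂ (inj₂ refl)) =
  ChangesRun⇒Drop {n} {c} {p + m} {m} (play-after wd run (<⇒≤ 2≤m) x<n) (weight-drop-end m 2≤m)

legal-drop : ∀ {c n x} → WellDominated n c → x < n → LegalMove n c x → Drop (potential c n) (potential (play x c) n)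
legal-drop {c} wd x<n L with run-containing c (target<n L) (target-free L)
... | p , m , run , p≤y , y<end =
  drop-near-run wd x<n run (run-length≥2 run L p≤y y<end) (position-near-run p≤y y<end (N[]-true⁻ (reaches-target L)))

freeCount-play : ∀ {c n x} → LegalMove n c x → freeCount (play x c) 0 n < freeCount c 0 n
freeCount-play {c} {n} {x} L =
  freeCount-strict (play-true x c) z≤n (target<n L) (target-free L) (play-N[] x c (reaches-target L))

playable-run : ∀ {c n} → 0 < potential c n → ∃₂ λ p m → Run c n p m × 2 ≤ m × gap m ∣ potential c n
playable-run {c} {n} W>0 with run-whose-gap-divides (runs c 0 n 0)
... | inj₁ W≡0 = ⊥-elim (<-irrefl (sym (trans (potential-runs c n) W≡0)) W>0)
... | inj₂ (m , m∈ , 2≤m , gm∣W) with run-of-∈ m∈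
...   | p , run = p , m , run , 2≤m , subst (gap m ∣_) (sym (potential-runs c n)) gm∣W

dominator-move : ∀ {c n} → 0 < potential c n →
  ∃[ x ] x < n × LegalMove n c x × potential (play x c) n + (8 + potential c n % 8) ≤ potential c n
dominator-move {c} {n} W>0 with playable-run W>0
... | p , m , run , 2≤m , gm∣W with dominator-split m 2≤m
...   | a , t , m≡1+a+t , 1≤t , big-drop =
  p + suc a , target<n L , L ,
  ChangesRun-+≤ {n} {c} {p + suc a} {m} (play-inside run (suc a) m≡1+a+t 1≤t)
    (≤-trans (+-monoʳ-≤ (weight a + weight (t ∸ 2)) (+-monoʳ-≤ 8 (gap∣⇒%8≤ {m} gm∣W))) big-drop)
  where
  1+a<m : suc a < m
  1+a<m = subst (suc a <_) (sym m≡1+a+t) (m<m+n (suc a) 1≤t)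
  L : LegalMove n c (p + suc a)
  L = legal-in-run run (m≤m+n p (suc a)) (+-monoʳ-< p 1+a<m) (m≤m+n p a) (+-monoʳ-< p (<-trans (n<1+n a) 1+a<m))
        (inj₂ (sym (+-suc p a))) (N[]-self (p + suc a))

legal-before-run : ∀ {c n p m} → Run c n (suc p) m → 2 ≤ m → LegalMove n c p
legal-before-run {p = p} {m} run 2≤m =
  legal-in-run run ≤-refl (m<m+n (suc p) (<⇒≤ 2≤m)) (n≤1+n _)
    (subst (_≤ suc p + m) (+-comm (suc p) 2) (+-monoʳ-≤ (suc p) 2≤m)) (inj₁ refl) (N[]-suc p)

legal-after-run : ∀ {c n p m} → Run c n p m → 2 ≤ m → LegalMove n c (p + m)
legal-after-run {m = suc zero} run (s≤s ())
legal-after-run {p = p} {suc (suc b)} run _ =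
  legal-in-run run (m≤m+n p (suc b)) (+-monoʳ-< p (n<1+n (suc b))) (m≤m+n p b) (+-monoʳ-< p (m<n⇒m<1+n (n<1+n b)))
    (inj₂ (sym (+-suc p b))) (subst (λ k → N[ k ] (p + suc b) ≡ true) (sym (+-suc p (suc b))) (N[]-pred (p + suc b)))

end-move : ∀ {c n p m} → WellDominated n c → (∃[ j ] j < n × c j ≡ true) → Run c n p m → 2 ≤ m →
           ∃[ x ] x < n × LegalMove n c x × ChangesRun n c x m (weight (m ∸ 1))
end-move {c} {n} {p} {m} wd (j , j<n , cj) run 2≤m with closedˡ run | closedʳ run
... | inj₂ (p′ , refl , _) | _ =
  p′ , <-trans (n<1+n p′) (target<n (legal-before-run run 2≤m)) , legal-before-run run 2≤m ,
  play-before wd run (<⇒≤ 2≤m)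
... | inj₁ refl | inj₁ m≡n       = ⊥-elim (≡true⇒≢false cj (free run z≤n (subst (j <_) (sym m≡n) j<n)))
... | inj₁ refl | inj₂ (m<n , _) = m , m<n , legal-after-run run 2≤m , play-after wd run (<⇒≤ 2≤m) m<n

staller-move : ∀ {c n} → WellDominated n c → (∃[ j ] j < n × c j ≡ true) → 0 < potential c n →
  ∃₂ λ x d → x < n × LegalMove n c x × d ∣ 8 × d ∣ potential c n × potential c n ≤ potential (play x c) n + d
staller-move {c} {n} wd dominated W>0 with playable-run W>0
... | p , m , run , 2≤m , gm∣W with end-move wd dominated run 2≤m
...   | x , x<n , L , changes =
  x , gap m , x<n , L , gap∣8 m , gm∣W , ChangesRun-≤+ {n} {c} {x} {m} changes (weight-drop-end≤gap m)

-- Game values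

Path-adjacent⁻ : ∀ {n} {y z : Fin n} → Path n y z ≡ true → suc (toℕ y) ≡ toℕ z ⊎ suc (toℕ z) ≡ toℕ y
Path-adjacent⁻ {y = y} {z} e with ∨-true⁻ {suc (toℕ y) ≡ᵇ toℕ z} e
... | inj₁ e′ = inj₁ (≡ᵇ-true⁻ e′)
... | inj₂ e′ = inj₂ (≡ᵇ-true⁻ e′)

Path-adjacent⁺ : ∀ {n} {y z : Fin n} → suc (toℕ y) ≡ toℕ z ⊎ suc (toℕ z) ≡ toℕ y → Path n y z ≡ true
Path-adjacent⁺ {y = y} {z} (inj₁ e) = ∨-trueˡ (suc (toℕ z) ≡ᵇ toℕ y) (≡ᵇ-true⁺ e)
Path-adjacent⁺ {y = y} {z} (inj₂ e) = ∨-trueʳ (suc (toℕ y) ≡ᵇ toℕ z) (≡ᵇ-true⁺ e)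

legal⇒LegalMove : ∀ {n} (S : List (Fin n)) x → legal (Path n) S x ≡ true → LegalMove n (dominatedBy S) (toℕ x)
legal⇒LegalMove {n} S x e with any-true⁻ _ (allFin n) e
... | y , _ , good∧reached with ∧-true⁻ {goodVertex (Path n) S y} good∧reached
...   | good , reached with ∧-true⁻ {not (dominatedBy S (toℕ y))} good
...     | y-free , has-free-neighbour with any-true⁻ _ (allFin n) has-free-neighbour
...       | z , _ , z-free∧adjacent with ∧-true⁻ {not (dominatedBy S (toℕ z))} z-free∧adjacent
...         | z-free , adjacent = record
  { target = toℕ y ; partner = toℕ z ; target<n = toℕ<n y ; partner<n = toℕ<n z
  ; target-free = not-true⁻ y-free ; partner-free = not-true⁻ z-free
  ; adjacent = Path-adjacent⁻ adjacent ; reaches-target = reached }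

LegalMove⇒legal : ∀ {n} (S : List (Fin n)) x → LegalMove n (dominatedBy S) (toℕ x) → legal (Path n) S x ≡ true
LegalMove⇒legal {n} S x L =
  any-true⁺ _ (∈-allFin y) (∧-true⁺ good (subst (λ k → N[ toℕ x ] k ≡ true) (sym toℕy≡) (reaches-target L)))
  where
  y z : Fin n
  y = fromℕ< (target<n L)
  z = fromℕ< (partner<n L)
  toℕy≡ : toℕ y ≡ target L
  toℕy≡ = toℕ-fromℕ< (target<n L)
  toℕz≡ : toℕ z ≡ partner L
  toℕz≡ = toℕ-fromℕ< (partner<n L)
  good : goodVertex (Path n) S y ≡ true
  good = ∧-true⁺ (not-true⁺ (subst (λ k → dominatedBy S k ≡ false) (sym toℕy≡) (target-free L)))
           (any-true⁺ _ (∈-allFin z)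
             (∧-true⁺ (not-true⁺ (subst (λ k → dominatedBy S k ≡ false) (sym toℕz≡) (partner-free L)))
                      (Path-adjacent⁺ (subst₂ (λ a b → suc a ≡ b ⊎ suc b ≡ a) (sym toℕy≡) (sym toℕz≡) (adjacent L)))))

∈legalMoves⇒LegalMove : ∀ {n} {S : List (Fin n)} {y} → y ∈ legalMoves (Path n) S → LegalMove n (dominatedBy S) (toℕ y)
∈legalMoves⇒LegalMove {n} {S} {y} y∈ =
  legal⇒LegalMove S y (Equivalence.to T-≡ (proj₂ (∈-filter⁻ (λ x → T? (legal (Path n) S x)) {xs = allFin n} y∈)))

LegalMove⇒∈legalMoves : ∀ {n} {S : List (Fin n)} {x} (x<n : x < n) → LegalMove n (dominatedBy S) x →
                        fromℕ< x<n ∈ legalMoves (Path n) S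
LegalMove⇒∈legalMoves {n} {S} x<n L = ∈-filter⁺ (λ x → T? (legal (Path n) S x)) (∈-allFin _)
  (Equivalence.from T-≡ (LegalMove⇒legal S _ (subst (LegalMove n (dominatedBy S)) (sym (toℕ-fromℕ< x<n)) L)))

best-dominator-≤ : ∀ x xs {v} → v ∈ x ∷ xs → best dominator x xs ≤ v
best-dominator-≤ x []       (here refl)         = ≤-refl
best-dominator-≤ x (y ∷ ys) (here refl)         = ≤-trans (m⊓n≤n y _) (best-dominator-≤ x ys (here refl))
best-dominator-≤ x (y ∷ ys) (there (here refl)) = m⊓n≤m y _
best-dominator-≤ x (y ∷ ys) (there (there v∈))  = ≤-trans (m⊓n≤n y _) (best-dominator-≤ x ys (there v∈))

best-staller-≥ : ∀ x xs {v} → v ∈ x ∷ xs → v ≤ best staller x xs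
best-staller-≥ x []       (here refl)         = ≤-refl
best-staller-≥ x (y ∷ ys) (here refl)         = ≤-trans (best-staller-≥ x ys (here refl)) (m≤n⊔m y _)
best-staller-≥ x (y ∷ ys) (there (here refl)) = m≤m⊔n y _
best-staller-≥ x (y ∷ ys) (there (there v∈))  = ≤-trans (best-staller-≥ x ys (there v∈)) (m≤n⊔m y _)

≤1+best-dominator : ∀ {c} x xs → All (λ v → c ≤ suc v) (x ∷ xs) → c ≤ suc (best dominator x xs)
≤1+best-dominator x []       (c≤1+x ∷ [])             = c≤1+x
≤1+best-dominator x (y ∷ ys) (c≤1+x ∷ c≤1+y ∷ bounds) = ⊓-glb c≤1+y (≤1+best-dominator x ys (c≤1+x ∷ bounds))

1+best-staller≤ : ∀ {c} x xs → All (λ v → suc v ≤ c) (x ∷ xs) → suc (best staller x xs) ≤ c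
1+best-staller≤ x []       (1+x≤c ∷ [])             = 1+x≤c
1+best-staller≤ x (y ∷ ys) (1+x≤c ∷ 1+y≤c ∷ bounds) = ⊔-lub 1+y≤c (1+best-staller≤ x ys (1+x≤c ∷ bounds))

module _ {n} (G : Graph n) {k : ℕ} {S : List (Fin n)} where

  value-dominator-≤ : ∀ {y} → y ∈ legalMoves G S →
                      gameValue G (suc k) dominator S ≤ suc (gameValue G k staller (y ∷ S))
  value-dominator-≤ y∈ with legalMoves G S
  ... | x ∷ xs = s≤s (best-dominator-≤ _ _ (∈-map⁺ (λ z → gameValue G k staller (z ∷ S)) y∈))

  value-dominator-≥ : ∀ {c y} → y ∈ legalMoves G S →
                      (∀ {z} → z ∈ legalMoves G S → c ≤ suc (gameValue G k staller (z ∷ S))) →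
                      c ≤ gameValue G (suc k) dominator S
  value-dominator-≥ y∈ bound with legalMoves G S
  ... | x ∷ xs = ≤1+best-dominator _ _ (All.map⁺ (All.tabulate bound))

  value-staller-≥ : ∀ {y} → y ∈ legalMoves G S → suc (gameValue G k dominator (y ∷ S)) ≤ gameValue G (suc k) staller S
  value-staller-≥ y∈ with legalMoves G S
  ... | x ∷ xs = s≤s (best-staller-≥ _ _ (∈-map⁺ (λ z → gameValue G k dominator (z ∷ S)) y∈))

  value-staller-≤ : ∀ {c} → (∀ {z} → z ∈ legalMoves G S → suc (gameValue G k dominator (z ∷ S)) ≤ c) →
                    gameValue G (suc k) staller S ≤ c
  value-staller-≤ bound with legalMoves G S
  ... | []     = z≤n
  ... | x ∷ xs = 1+best-staller≤ _ _ (All.map⁺ (All.tabulate bound))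

  value-without-moves : ∀ p → (∀ {z} → z ∈ legalMoves G S → ⊥) → gameValue G (suc k) p S ≡ 0
  value-without-moves p none with legalMoves G S
  ... | []    = refl
  ... | x ∷ _ = ⊥-elim (none (here refl))

potential-pos⇒freeCount-pos : ∀ {c n} → 0 < potential c n → 0 < freeCount c 0 n
potential-pos⇒freeCount-pos {c} {n} W>0 with playable-run W>0
... | p , m , run , 2≤m , _ = freeCount-pos c z≤n (<-≤-trans (m<m+n p (<⇒≤ 2≤m)) (fits run))
                              (free run ≤-refl (m<m+n p (<⇒≤ 2≤m)))

module _ {n : ℕ} where

  Φ : List (Fin n) → ℕ
  Φ S = potential (dominatedBy S) n

  Values : ℕ → List (Fin n) → Set
  Values k S = gameValue (Path n) k dominator S ≡ Φ S / 8 × gameValue (Path n) k staller S ≡ ⌈ Φ S /8⌉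

  legalMoves-drop : ∀ {S y} → y ∈ legalMoves (Path n) S → Drop (Φ S) (Φ (y ∷ S))
  legalMoves-drop {S} {y} y∈ = legal-drop (dominatedBy-wellDominated S) (toℕ<n y) (∈legalMoves⇒LegalMove {S = S} y∈)

  as-legalMove : ∀ {S x} (P : (ℕ → Bool) → Set) (x<n : x < n) → LegalMove n (dominatedBy S) x →
                 P (play x (dominatedBy S)) → ∃[ y ] y ∈ legalMoves (Path n) S × P (dominatedBy (y ∷ S))
  as-legalMove {S} P x<n L Px = fromℕ< x<n , LegalMove⇒∈legalMoves {S = S} x<n L ,
                                subst (λ k → P (play k (dominatedBy S))) (sym (toℕ-fromℕ< x<n)) Px

  Φ≡0⇒Values : ∀ k S → Φ S ≡ 0 → Values k S
  Φ≡0⇒Values zero    S Φ≡0 = sym (cong (_/ 8) Φ≡0) , sym (cong ⌈_/8⌉ Φ≡0)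
  Φ≡0⇒Values (suc k) S Φ≡0 =
    trans (value-without-moves _ dominator no-move) (sym (cong (_/ 8) Φ≡0)) ,
    trans (value-without-moves _ staller no-move) (sym (cong ⌈_/8⌉ Φ≡0))
    where
    no-move : ∀ {z} → z ∈ legalMoves (Path n) S → ⊥
    no-move {z} z∈ = n≮0 (subst (Φ (z ∷ S) <_) Φ≡0 (proj₁ (legalMoves-drop {S} {z} z∈)))

  module InductionStep (k : ℕ) (S : List (Fin n)) (Φ>0 : 0 < Φ S) (dominated : ∃[ j ] j < n × dominatedBy S j ≡ true)
                       (ih : ∀ {y} → y ∈ legalMoves (Path n) S → Values k (y ∷ S)) where

    dominator-≤ : gameValue (Path n) (suc k) dominator S ≤ Φ S / 8
    dominator-≤ =
      let x , x<n , L , big = dominator-move {dominatedBy S} {n} Φ>0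
          y , y∈ , big′ = as-legalMove {S} (λ c → potential c n + (8 + Φ S % 8) ≤ Φ S) x<n L big
      in ≤-trans (value-dominator-≤ (Path n) y∈)
                 (subst (λ v → suc v ≤ Φ S / 8) (sym (proj₂ (ih y∈))) (+8+%8≤⇒1+⌈/8⌉≤⌊/8⌋ big′))

    dominator-≥ : Φ S / 8 ≤ gameValue (Path n) (suc k) dominator S
    dominator-≥ =
      let x , x<n , L , _ = dominator-move {dominatedBy S} {n} Φ>0
      in value-dominator-≥ (Path n) (LegalMove⇒∈legalMoves {S = S} x<n L) λ {z} z∈ →
           subst (λ v → Φ S / 8 ≤ suc v) (sym (proj₂ (ih z∈))) (≤+15⇒⌊/8⌋≤1+⌈/8⌉ (proj₂ (legalMoves-drop {S} {z} z∈)))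

    staller-≤ : gameValue (Path n) (suc k) staller S ≤ ⌈ Φ S /8⌉
    staller-≤ = value-staller-≤ (Path n) λ {z} z∈ →
      subst (λ v → suc v ≤ ⌈ Φ S /8⌉) (sym (proj₁ (ih z∈))) (<⇒1+⌊/8⌋≤⌈/8⌉ (proj₁ (legalMoves-drop {S} {z} z∈)))

    staller-≥ : ⌈ Φ S /8⌉ ≤ gameValue (Path n) (suc k) staller S
    staller-≥ =
      let x , d , x<n , L , d∣8 , d∣Φ , small =
            staller-move {dominatedBy S} {n} (dominatedBy-wellDominated S) dominated Φ>0
          y , y∈ , small′ = as-legalMove {S} (λ c → Φ S ≤ potential c n + d) x<n L small
      in ≤-trans (subst (⌈ Φ S /8⌉ ≤_) (cong suc (sym (proj₁ (ih y∈)))) (∣8∣⇒⌈/8⌉≤1+⌊/8⌋ d∣8 d∣Φ small′))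
                 (value-staller-≥ (Path n) y∈)

  exact-value : ∀ k s S → freeCount (dominatedBy (s ∷ S)) 0 n ≤ k → Values k (s ∷ S)
  exact-value zero s S free≤0 =
    Φ≡0⇒Values 0 (s ∷ S) (n≤0⇒n≡0 (≮⇒≥ λ Φ>0 → <-irrefl refl (<-≤-trans (potential-pos⇒freeCount-pos Φ>0) free≤0)))
  exact-value (suc k) s S free≤ with 0 <? Φ (s ∷ S)
  ... | no Φ≯0  = Φ≡0⇒Values (suc k) (s ∷ S) (n≤0⇒n≡0 (≮⇒≥ Φ≯0))
  ... | yes Φ>0 = ≤-antisym dominator-≤ dominator-≥ , ≤-antisym staller-≤ staller-≥
    where
    open InductionStep k (s ∷ S) Φ>0 (toℕ s , toℕ<n s , ∨-trueˡ _ (N[]-self (toℕ s))) (λ {y} y∈ →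
      exact-value k y (s ∷ S) (≤-pred (≤-trans (freeCount-play (∈legalMoves⇒LegalMove {S = s ∷ S} y∈)) free≤)))

-- The opening move

Φ-opening : ∀ {n} (y : Fin n) {t} → toℕ y + t ≡ n → Φ (y ∷ []) ≡ weight (toℕ y ∸ 1) + weight (t ∸ 2)
Φ-opening {n} y {t} i+t≡n = begin
  Φ (y ∷ [])
    ≡⟨ potential-runs (dominatedBy (y ∷ [])) n ⟩
  weightSum (runs (dominatedBy (y ∷ [])) 0 n 0)
    ≡⟨ cong weightSum (runs-cong {dominatedBy (y ∷ [])} {N[ toℕ y ]} {0} {n} {0} λ _ _ → ∨-identityʳ _) ⟩
  weightSum (runs N[ toℕ y ] 0 n 0)
    ≡⟨ cong (λ k → weightSum (runs N[ toℕ y ] 0 k 0)) (sym i+t≡n) ⟩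
  weightSum (runs N[ toℕ y ] 0 (toℕ y + t) 0)
    ≡⟨ weightSum-play-inside 0 (toℕ y) t ⟩
  weight (toℕ y ∸ 1) + weight (t ∸ 2) ∎
  where open ≡-Reasoning

freeCount-opening : ∀ {n′} (y : Fin (suc n′)) → freeCount (dominatedBy (y ∷ [])) 0 (suc n′) ≤ n′
freeCount-opening {n′} y = ≤-pred (<-≤-trans
  (freeCount-strict (play-true (toℕ y) nothing) z≤n (toℕ<n y) refl (play-N[] (toℕ y) nothing (N[]-self (toℕ y))))
  (freeCount≤ nothing 0 (suc n′)))
  where
  nothing : ℕ → Bool
  nothing = dominatedBy {suc n′} []

opening-values : ∀ {n′} (y : Fin (suc n′)) {t} → toℕ y + t ≡ suc n′ →
  gameValue (Path (suc n′)) n′ dominator (y ∷ []) ≡ (weight (toℕ y ∸ 1) + weight (t ∸ 2)) / 8 ×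
  gameValue (Path (suc n′)) n′ staller (y ∷ []) ≡ ⌈ weight (toℕ y ∸ 1) + weight (t ∸ 2) /8⌉
opening-values {n′} y i+t≡n with exact-value n′ y [] (freeCount-opening y)
... | dominator-value , staller-value =
  trans dominator-value (cong (_/ 8) (Φ-opening y i+t≡n)) , trans staller-value (cong ⌈_/8⌉ (Φ-opening y i+t≡n))

opening-move : ∀ {n i t} → i + t ≡ n → 2 ≤ t → ∃[ y ] toℕ y ≡ i × y ∈ legalMoves (Path n) []
opening-move {n} {i} {t} i+t≡n 2≤t = fromℕ< i<n , toℕ-fromℕ< i<n , LegalMove⇒∈legalMoves {S = []} i<n record
  { target = i ; partner = suc i ; target<n = i<n ; partner<n = 1+i<n ; target-free = refl ; partner-free = refl
  ; adjacent = inj₁ refl ; reaches-target = N[]-self i }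
  where
  1+i<n : suc i < n
  1+i<n = subst (2 + i ≤_) i+t≡n (subst (_≤ i + t) (+-comm i 2) (+-monoʳ-≤ i 2≤t))
  i<n : i < n
  i<n = <-trans (n<1+n i) 1+i<n

opening-bound : ∀ {n} (y : Fin n) → 3 ≤ n →
                suc ((weight (toℕ y ∸ 1) + weight ((n ∸ toℕ y) ∸ 2)) / 8) ≤ (2 * n + 2) / 5
opening-bound {n} y 3≤n =
  subst (λ k → suc ((weight (toℕ y ∸ 1) + weight ((n ∸ toℕ y) ∸ 2)) / 8) ≤ (2 * k + 2) / 5) i+t≡n
        (opening-bound-split (toℕ y) (n ∸ toℕ y) (m<n⇒0<n∸m (toℕ<n y)) (subst (3 ≤_) (sym i+t≡n) 3≤n))
  where
  i+t≡n : toℕ y + (n ∸ toℕ y) ≡ n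
  i+t≡n = m+[n∸m]≡n (<⇒≤ (toℕ<n y))

balanced-opening : ∀ {n} → 3 ≤ n →
  ∃[ y ] ∃[ t ] y ∈ legalMoves (Path n) [] × toℕ y + t ≡ n × 8 ∣ weight (toℕ y ∸ 1) + weight (t ∸ 2)
balanced-opening {1} (s≤s ())
balanced-opening {2} (s≤s (s≤s ()))
balanced-opening {suc (suc (suc k))} _ with balanced-opening-split k
... | i , t , i+t≡n , 3≤t , 8∣F with opening-move {i = i} {t} i+t≡n (<⇒≤ 3≤t)
...   | y , refl , y∈ = y , t , y∈ , i+t≡n , 8∣F

lemma4p3 : (n : ℕ) → 3 ≤ n →
    (ιg (Path n) ≤ ιg' (Path n)) × (ιg' (Path n) ≤ (2 * n + 2) / 5)
lemma4p3 n@(suc n′) 3≤n = ιg≤ιg′ , ιg′≤bound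
  where
  ιg′≤bound : ιg' (Path n) ≤ (2 * n + 2) / 5
  ιg′≤bound = value-staller-≤ (Path n) λ {z} _ →
    subst (λ v → suc v ≤ (2 * n + 2) / 5) (sym (proj₁ (opening-values z (m+[n∸m]≡n (<⇒≤ (toℕ<n z))))))
      (opening-bound z 3≤n)
  ιg≤ιg′ : ιg (Path n) ≤ ιg' (Path n)
  ιg≤ιg′ =
    let y , t , y∈ , i+t≡n , 8∣F = balanced-opening 3≤n
        dominator-value , staller-value = opening-values y i+t≡n
    in begin
    ιg (Path n)                                     ≤⟨ value-dominator-≤ (Path n) y∈ ⟩
    suc (gameValue (Path n) n′ staller (y ∷ []))    ≡⟨ cong suc (trans staller-value (8∣⇒⌈/8⌉≡/8 8∣F)) ⟩
    suc ((weight (toℕ y ∸ 1) + weight (t ∸ 2)) / 8) ≡⟨ cong suc (sym dominator-value) ⟩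
    suc (gameValue (Path n) n′ dominator (y ∷ []))  ≤⟨ value-staller-≥ (Path n) y∈ ⟩
    ιg' (Path n)                                    ∎
    where open ≤-Reasoning
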